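{- Let $S = \{(a_1,b_1),\dots,(a_r,b_r)\} \subset \mathbb{A}^2(\mathbb{Q})$ be an acceptable set with $r \ge 2$. Put $d = 18r+3$, $m = \prod_{1 \le j < k \le r}(a_j - a_k)$, $N = \prod_{p \text{ prime},\, v_p(m)>0} p$, and $$g(X,t) = t N^6 \prod_{i=1}^r (X-a_i)^6 + 1 \in \mathbb{Q}[X,t].$$ Let $h(X) \in \mathbb{Q}[X]$ be an irreducible polynomial of degree $6r+3$ such that $h(a_i) = b_i^d$ for all $i$ and $m\cdot h(X) \in \mathbb{Z}[X]$. Then for all but finitely many primes $p$, the polynomial $$(h(X)-1)\,g(X,p) + 1$$ is separable.
   Context: A finite set $S = \{(a_1,b_1),\dots,(a_r,b_r)\} \subset \mathbb{A}^2(\mathbb{Q})$ of distinct rational points is called acceptable if (i) $a_i = a_j$ implies $b_i = b_j$ (so the $a_i$ are pairwise distinct), (ii) $a_i \neq 0$ and $b_j \neq 0$ for all $i,j$, and (iii) $a_i, b_j \in \mathbb{Z}$ for all $i,j$. The paper assumes throughout this part that $r = |S| \ge 2$. $v_p$ denotes the $p$-adic valuation. -}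

module Defs where

open import Data.Nat as ℕ using (ℕ; zero; suc)
open import Data.Nat.Primality using (Prime; prime?)
open import Data.Nat.Divisibility using (_∣_; _∣?_)
open import Data.Integer as ℤ using (ℤ; +_)
open import Data.Rational as ℚ using (ℚ; 0ℚ; 1ℚ)
open import Data.Fin using (Fin)
import Data.Fin as Fin
open import Data.List using (List; []; _∷_; filter; upTo)
open import Data.Nat.ListAction using (product)
open import Data.Product using (Σ; _×_; _,_)
open import Data.Sum using (_⊎_)
open import Relation.Nullary using (¬_)
open import Relation.Nullary.Decidable using (_×-dec_)
open import Relation.Binary.PropositionalEquality using (_≡_; _≢_)

ι : ℤ → ℚ
ι z = z ℚ./ 1

-- Polynomials in one variable over ℚ: coefficient lists, lowest degree
-- first.  Two lists represent the same polynomial iff all coefficients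
-- agree (trailing zeros are irrelevant).

Poly : Set
Poly = List ℚ

coeff : Poly → ℕ → ℚ
coeff []       _       = 0ℚ
coeff (c ∷ _)  zero    = c
coeff (_ ∷ cs) (suc n) = coeff cs n

infix 4 _≈ₚ_
_≈ₚ_ : Poly → Poly → Set
p ≈ₚ q = ∀ n → coeff p n ≡ coeff q n

constP : ℚ → Poly
constP c = c ∷ []

oneP : Poly
oneP = constP 1ℚ

XP : Poly
XP = 0ℚ ∷ 1ℚ ∷ []

infixl 6 _+ₚ_ _-ₚ_
infixl 7 _*ₚ_ _·ₚ_

_+ₚ_ : Poly → Poly → Poly
[]       +ₚ q        = q
(a ∷ as) +ₚ []       = a ∷ as
(a ∷ as) +ₚ (b ∷ bs) = (a ℚ.+ b) ∷ (as +ₚ bs)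

_·ₚ_ : ℚ → Poly → Poly
c ·ₚ []       = []
c ·ₚ (a ∷ as) = (c ℚ.* a) ∷ (c ·ₚ as)

negP : Poly → Poly
negP p = (ℚ.- 1ℚ) ·ₚ p

_-ₚ_ : Poly → Poly → Poly
p -ₚ q = p +ₚ negP q

_*ₚ_ : Poly → Poly → Poly
[]       *ₚ q = []
(a ∷ as) *ₚ q = (a ·ₚ q) +ₚ (0ℚ ∷ (as *ₚ q))

_^ₚ_ : Poly → ℕ → Poly
p ^ₚ zero  = oneP
p ^ₚ suc n = p *ₚ (p ^ₚ n)

eval : Poly → ℚ → ℚ
eval []       x = 0ℚ
eval (a ∷ as) x = a ℚ.+ (x ℚ.* eval as x)

derivAux : ℕ → Poly → Poly
derivAux k []       = []
derivAux k (a ∷ as) = (ι (+ k) ℚ.* a) ∷ derivAux (suc k) as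

deriv : Poly → Poly
deriv []       = []
deriv (_ ∷ as) = derivAux 1 as

HasDegree : Poly → ℕ → Set
HasDegree p n = (coeff p n ≢ 0ℚ) × (∀ k → n ℕ.< k → coeff p k ≡ 0ℚ)

IsConst : Poly → Set
IsConst p = ∀ k → 1 ℕ.≤ k → coeff p k ≡ 0ℚ

-- irreducible in ℚ[X]: not a constant (so neither zero nor a unit), and
-- every factorisation has a unit (= constant, necessarily nonzero) factor
Irreducible : Poly → Set
Irreducible p = ¬ IsConst p × (∀ f g → p ≈ₚ f *ₚ g → IsConst f ⊎ IsConst g)

Separable : Poly → Set
Separable p = Σ Poly λ u → Σ Poly λ v → u *ₚ p +ₚ v *ₚ deriv p ≈ₚ oneP

IntegralPoly : Poly → Set
IntegralPoly p = ∀ n → Σ ℤ λ z → coeff p n ≡ ι z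

prodFin : (n : ℕ) → (Fin n → ℤ) → ℤ
prodFin zero    f = + 1
prodFin (suc n) f = f Fin.zero ℤ.* prodFin n (λ k → f (Fin.suc k))

-- m = ∏_{1 ≤ j < k ≤ r} (a_j - a_k)   (indices 0-based here)
mProd : (r : ℕ) → (Fin r → ℤ) → ℤ
mProd zero    a = + 1
mProd (suc r) a =
  prodFin r (λ k → a Fin.zero ℤ.- a (Fin.suc k)) ℤ.* mProd r (λ k → a (Fin.suc k))

rad : ℕ → ℕ
rad n = product (filter (λ p → prime? p ×-dec p ∣? n) (upTo (suc n)))

prodLin : (r : ℕ) → (Fin r → ℤ) → Poly
prodLin zero    a = oneP
prodLin (suc r) a = (XP -ₚ constP (ι (a Fin.zero))) *ₚ prodLin r (λ k → a (Fin.suc k))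

gPoly : (r : ℕ) → (Fin r → ℤ) → ℚ → Poly
gPoly r a t =
  ((t ℚ.* ι (+ (rad (ℤ.∣ mProd r a ∣) ℕ.^ 6))) ·ₚ (prodLin r a ^ₚ 6)) +ₚ oneP

Acceptable : (r : ℕ) → (Fin r → ℤ) → (Fin r → ℤ) → Set
Acceptable r a b =
  (∀ i j → a i ≡ a j → i ≡ j) × (∀ i → a i ≢ + 0) × (∀ j → b j ≢ + 0)

-- Write L = ∏ (X - aᵢ) and F = (h - 1) g(X, p) + 1 = h + p N⁶ L⁶ (h - 1). After scaling by m
-- everything is integral and m F ≡ m h (mod p). Since h is irreducible it is separable, and
-- clearing denominators in a Bézout relation for h and h′ gives u (m h) + v (m h)′ = D with
-- u, v integral and D a nonzero integer; so for p ∤ D, m h stays separable modulo p.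
-- The leading coefficient of m F is p N⁶ z with z = m lc(h), exactly divisible by p when p > N, |z|.
-- If e² ∣ F with e nonconstant, rescale e to an integral E that does not vanish modulo p; by
-- Gauss's lemma c m F = E² T with T integral and p ∤ c. Modulo p, E then divides the unit c D,
-- so every nonconstant coefficient of E is a multiple of p, and p² divides the leading
-- coefficient of c m F, a contradiction. Hence F is square-free, so separable, for p > N + |z| + |D|.

module Submission where

open import Defs
open import Data.Nat as ℕ using (ℕ; zero; suc; _≤_; _<_; z≤n; s≤s; _∸_; _+_; _*_)
import Data.Nat.Properties as ℕP
open import Data.Integer as ℤ using (ℤ; +_)
import Data.Integer.Properties as ℤP
open import Data.Rational as ℚ using (ℚ; 0ℚ; 1ℚ; mkℚ)
import Data.Rational.Properties as ℚP
import Data.Rational.Unnormalised as ℚᵘ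
import Data.Rational.Unnormalised.Properties as ℚᵘP
open import Data.List using ([]; _∷_; length; upTo)
import Data.List.Relation.Unary.All as All
open import Data.List.Relation.Unary.All.Properties using (all-filter)
import Data.Fin.Properties as FinP
open import Function using (id)
open import Data.Maybe using (Maybe; just; nothing)
open import Data.Product using (Σ; _×_; _,_; proj₁; proj₂)
open import Data.Sum using (_⊎_; inj₁; inj₂; [_,_]′)
open import Data.Fin as Fin using (Fin)
open import Data.Empty using (⊥-elim)
open import Relation.Nullary using (¬_; Dec; yes; no)
open import Relation.Nullary.Decidable using (map′; _×-dec_)
open import Relation.Binary.PropositionalEquality
open import Relation.Binary using (IsEquivalence; Setoid)
open import Relation.Binary.Definitions using (tri<; tri≈; tri>)
import Relation.Binary.Reasoning.Setoid as SetoidReasoning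
open import Algebra.Bundles using (CommutativeRing)
open import Algebra.Structures using (IsCommutativeRing)
import Algebra.Solver.Ring.AlmostCommutativeRing as ACR
import Algebra.Solver.Ring as RingSolver
open import Data.Integer.Solver renaming (module +-*-Solver to ℤ-Solver)
open import Data.Rational.Solver renaming (module +-*-Solver to ℚ-Solver)
open import Data.Nat.Primality using (Prime; prime?; euclidsLemma; prime⇒nonTrivial; prime⇒nonZero; productOfPrimes≢0)
open import Data.Nat.Divisibility using (_∣_; _∣?_; divides; >⇒∤; ∣1⇒≡1)
open import Data.Nat.Induction using (<-wellFounded)
open import Induction.WellFounded using (Acc; acc)
import Data.Integer.Divisibility.Signed as ℤS

-- Wrapping _≈ₚ_ in a record makes both polynomials inferable from a proof of equality.
infix 4 _≋_
record _≋_ (p q : Poly) : Set where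
  constructor mk≋
  field coeff≡ : ∀ n → coeff p n ≡ coeff q n
open _≋_ public

≋-refl : ∀ {p} → p ≋ p
≋-refl = mk≋ λ _ → refl

≋-sym : ∀ {p q} → p ≋ q → q ≋ p
≋-sym e = mk≋ λ n → sym (coeff≡ e n)

≋-trans : ∀ {p q r} → p ≋ q → q ≋ r → p ≋ r
≋-trans e f = mk≋ λ n → trans (coeff≡ e n) (coeff≡ f n)

≋-isEquivalence : IsEquivalence _≋_
≋-isEquivalence = record { refl = ≋-refl ; sym = ≋-sym ; trans = ≋-trans }

≋-setoid : Setoid _ _
≋-setoid = record { isEquivalence = ≋-isEquivalence }

module ≋-Reasoning = SetoidReasoning ≋-setoid

∷-cong : ∀ {a b p q} → a ≡ b → p ≋ q → a ∷ p ≋ b ∷ q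
∷-cong e f = mk≋ λ { zero → e ; (suc n) → coeff≡ f n }

∷-injectiveʳ : ∀ {a b p q} → a ∷ p ≋ b ∷ q → p ≋ q
∷-injectiveʳ e = mk≋ λ n → coeff≡ e (suc n)

0∷-≋[] : ∀ {p} → p ≋ [] → 0ℚ ∷ p ≋ []
0∷-≋[] e = mk≋ λ { zero → refl ; (suc n) → coeff≡ e n }

∷-≋[]⇒≋[] : ∀ {a p} → a ∷ p ≋ [] → p ≋ []
∷-≋[]⇒≋[] e = mk≋ λ n → coeff≡ e (suc n)

coeff-+ₚ : ∀ p q n → coeff (p +ₚ q) n ≡ coeff p n ℚ.+ coeff q n
coeff-+ₚ []       q        n       = sym (ℚP.+-identityˡ _)
coeff-+ₚ (a ∷ as) []       n       = sym (ℚP.+-identityʳ _)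
coeff-+ₚ (a ∷ as) (b ∷ bs) zero    = refl
coeff-+ₚ (a ∷ as) (b ∷ bs) (suc n) = coeff-+ₚ as bs n

coeff-·ₚ : ∀ c p n → coeff (c ·ₚ p) n ≡ c ℚ.* coeff p n
coeff-·ₚ c []       n       = sym (ℚP.*-zeroʳ c)
coeff-·ₚ c (a ∷ as) zero    = refl
coeff-·ₚ c (a ∷ as) (suc n) = coeff-·ₚ c as n

coeff-negP : ∀ p n → coeff (negP p) n ≡ ℚ.- coeff p n
coeff-negP p n = begin
  coeff (negP p) n             ≡⟨ coeff-·ₚ (ℚ.- 1ℚ) p n ⟩
  ℚ.- 1ℚ ℚ.* coeff p n         ≡⟨ ℚP.neg-distribˡ-* 1ℚ (coeff p n) ⟨
  ℚ.- (1ℚ ℚ.* coeff p n)       ≡⟨ cong ℚ.-_ (ℚP.*-identityˡ _) ⟩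
  ℚ.- coeff p n                ∎
  where open ≡-Reasoning

coeff--ₚ : ∀ p q n → coeff (p -ₚ q) n ≡ coeff p n ℚ.- coeff q n
coeff--ₚ p q n = trans (coeff-+ₚ p (negP q) n) (cong (coeff p n ℚ.+_) (coeff-negP q n))

+ₚ-cong : ∀ {p p′ q q′} → p ≋ p′ → q ≋ q′ → p +ₚ q ≋ p′ +ₚ q′
+ₚ-cong {p} {p′} {q} {q′} e f = mk≋ λ n → begin
  coeff (p +ₚ q) n               ≡⟨ coeff-+ₚ p q n ⟩
  coeff p n ℚ.+ coeff q n        ≡⟨ cong₂ ℚ._+_ (coeff≡ e n) (coeff≡ f n) ⟩
  coeff p′ n ℚ.+ coeff q′ n      ≡⟨ coeff-+ₚ p′ q′ n ⟨
  coeff (p′ +ₚ q′) n             ∎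
  where open ≡-Reasoning

·ₚ-cong : ∀ {c d p q} → c ≡ d → p ≋ q → c ·ₚ p ≋ d ·ₚ q
·ₚ-cong {c} {d} {p} {q} e f = mk≋ λ n → begin
  coeff (c ·ₚ p) n    ≡⟨ coeff-·ₚ c p n ⟩
  c ℚ.* coeff p n     ≡⟨ cong₂ ℚ._*_ e (coeff≡ f n) ⟩
  d ℚ.* coeff q n     ≡⟨ coeff-·ₚ d q n ⟨
  coeff (d ·ₚ q) n    ∎
  where open ≡-Reasoning

negP-cong : ∀ {p q} → p ≋ q → negP p ≋ negP q
negP-cong = ·ₚ-cong refl

+ₚ-comm : ∀ p q → p +ₚ q ≋ q +ₚ p
+ₚ-comm p q = mk≋ λ n →
  trans (coeff-+ₚ p q n) (trans (ℚP.+-comm (coeff p n) (coeff q n)) (sym (coeff-+ₚ q p n)))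

+ₚ-assoc : ∀ p q r → (p +ₚ q) +ₚ r ≋ p +ₚ (q +ₚ r)
+ₚ-assoc p q r = mk≋ λ n → begin
  coeff ((p +ₚ q) +ₚ r) n                   ≡⟨ coeff-+ₚ (p +ₚ q) r n ⟩
  coeff (p +ₚ q) n ℚ.+ coeff r n            ≡⟨ cong (ℚ._+ coeff r n) (coeff-+ₚ p q n) ⟩
  (coeff p n ℚ.+ coeff q n) ℚ.+ coeff r n   ≡⟨ ℚP.+-assoc (coeff p n) (coeff q n) (coeff r n) ⟩
  coeff p n ℚ.+ (coeff q n ℚ.+ coeff r n)   ≡⟨ cong (coeff p n ℚ.+_) (coeff-+ₚ q r n) ⟨
  coeff p n ℚ.+ coeff (q +ₚ r) n            ≡⟨ coeff-+ₚ p (q +ₚ r) n ⟨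
  coeff (p +ₚ (q +ₚ r)) n                   ∎
  where open ≡-Reasoning

+ₚ-identityˡ : ∀ p → [] +ₚ p ≋ p
+ₚ-identityˡ p = ≋-refl

+ₚ-identityʳ : ∀ p → p +ₚ [] ≋ p
+ₚ-identityʳ []      = ≋-refl
+ₚ-identityʳ (a ∷ p) = ≋-refl

+ₚ-inverseʳ : ∀ p → p +ₚ negP p ≋ []
+ₚ-inverseʳ p = mk≋ λ n → trans (coeff--ₚ p p n) (ℚP.+-inverseʳ (coeff p n))

+ₚ-inverseˡ : ∀ p → negP p +ₚ p ≋ []
+ₚ-inverseˡ p = ≋-trans (+ₚ-comm (negP p) p) (+ₚ-inverseʳ p)

+ₚ-interchange : ∀ w x y z → (w +ₚ x) +ₚ (y +ₚ z) ≋ (w +ₚ y) +ₚ (x +ₚ z)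
+ₚ-interchange w x y z = begin
  (w +ₚ x) +ₚ (y +ₚ z)   ≈⟨ +ₚ-assoc w x (y +ₚ z) ⟩
  w +ₚ (x +ₚ (y +ₚ z))   ≈⟨ +ₚ-cong (≋-refl {w}) (≋-sym (+ₚ-assoc x y z)) ⟩
  w +ₚ ((x +ₚ y) +ₚ z)   ≈⟨ +ₚ-cong (≋-refl {w}) (+ₚ-cong (+ₚ-comm x y) ≋-refl) ⟩
  w +ₚ ((y +ₚ x) +ₚ z)   ≈⟨ +ₚ-cong (≋-refl {w}) (+ₚ-assoc y x z) ⟩
  w +ₚ (y +ₚ (x +ₚ z))   ≈⟨ +ₚ-assoc w y (x +ₚ z) ⟨
  (w +ₚ y) +ₚ (x +ₚ z)   ∎
  where open ≋-Reasoning

0∷-+ₚ : ∀ p q → (0ℚ ∷ p) +ₚ (0ℚ ∷ q) ≋ 0ℚ ∷ (p +ₚ q)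
0∷-+ₚ p q = ∷-cong (ℚP.+-identityˡ 0ℚ) ≋-refl

·ₚ-distribˡ-+ₚ : ∀ c p q → c ·ₚ (p +ₚ q) ≋ c ·ₚ p +ₚ c ·ₚ q
·ₚ-distribˡ-+ₚ c p q = mk≋ λ n → begin
  coeff (c ·ₚ (p +ₚ q)) n                   ≡⟨ coeff-·ₚ c (p +ₚ q) n ⟩
  c ℚ.* coeff (p +ₚ q) n                    ≡⟨ cong (c ℚ.*_) (coeff-+ₚ p q n) ⟩
  c ℚ.* (coeff p n ℚ.+ coeff q n)           ≡⟨ ℚP.*-distribˡ-+ c _ _ ⟩
  c ℚ.* coeff p n ℚ.+ c ℚ.* coeff q n       ≡⟨ cong₂ ℚ._+_ (coeff-·ₚ c p n) (coeff-·ₚ c q n) ⟨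
  coeff (c ·ₚ p) n ℚ.+ coeff (c ·ₚ q) n     ≡⟨ coeff-+ₚ (c ·ₚ p) (c ·ₚ q) n ⟨
  coeff (c ·ₚ p +ₚ c ·ₚ q) n                ∎
  where open ≡-Reasoning

·ₚ-distribʳ-+ : ∀ c d p → (c ℚ.+ d) ·ₚ p ≋ c ·ₚ p +ₚ d ·ₚ p
·ₚ-distribʳ-+ c d p = mk≋ λ n → begin
  coeff ((c ℚ.+ d) ·ₚ p) n                  ≡⟨ coeff-·ₚ (c ℚ.+ d) p n ⟩
  (c ℚ.+ d) ℚ.* coeff p n                   ≡⟨ ℚP.*-distribʳ-+ (coeff p n) c d ⟩
  c ℚ.* coeff p n ℚ.+ d ℚ.* coeff p n       ≡⟨ cong₂ ℚ._+_ (coeff-·ₚ c p n) (coeff-·ₚ d p n) ⟨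
  coeff (c ·ₚ p) n ℚ.+ coeff (d ·ₚ p) n     ≡⟨ coeff-+ₚ (c ·ₚ p) (d ·ₚ p) n ⟨
  coeff (c ·ₚ p +ₚ d ·ₚ p) n                ∎
  where open ≡-Reasoning

·ₚ-assoc : ∀ c d p → c ·ₚ (d ·ₚ p) ≋ (c ℚ.* d) ·ₚ p
·ₚ-assoc c d p = mk≋ λ n → begin
  coeff (c ·ₚ (d ·ₚ p)) n      ≡⟨ coeff-·ₚ c (d ·ₚ p) n ⟩
  c ℚ.* coeff (d ·ₚ p) n       ≡⟨ cong (c ℚ.*_) (coeff-·ₚ d p n) ⟩
  c ℚ.* (d ℚ.* coeff p n)      ≡⟨ ℚP.*-assoc c d _ ⟨
  (c ℚ.* d) ℚ.* coeff p n      ≡⟨ coeff-·ₚ (c ℚ.* d) p n ⟨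
  coeff ((c ℚ.* d) ·ₚ p) n     ∎
  where open ≡-Reasoning

·ₚ-identity : ∀ p → 1ℚ ·ₚ p ≋ p
·ₚ-identity p = mk≋ λ n → trans (coeff-·ₚ 1ℚ p n) (ℚP.*-identityˡ (coeff p n))

·ₚ-zero : ∀ p → 0ℚ ·ₚ p ≋ []
·ₚ-zero p = mk≋ λ n → trans (coeff-·ₚ 0ℚ p n) (ℚP.*-zeroˡ (coeff p n))

≋[]⇒*ₚ≋[] : ∀ p q → p ≋ [] → p *ₚ q ≋ []
≋[]⇒*ₚ≋[] []       q e = ≋-refl
≋[]⇒*ₚ≋[] (a ∷ as) q e = begin
  a ·ₚ q +ₚ (0ℚ ∷ (as *ₚ q))   ≈⟨ +ₚ-cong (·ₚ-cong (coeff≡ e 0) ≋-refl) (0∷-≋[] (≋[]⇒*ₚ≋[] as q (∷-≋[]⇒≋[] e))) ⟩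
  0ℚ ·ₚ q +ₚ []                ≈⟨ +ₚ-identityʳ _ ⟩
  0ℚ ·ₚ q                      ≈⟨ ·ₚ-zero q ⟩
  []                           ∎
  where open ≋-Reasoning

*ₚ-congˡ : ∀ {p p′} q → p ≋ p′ → p *ₚ q ≋ p′ *ₚ q
*ₚ-congˡ {[]}     {[]}     q e = ≋-refl
*ₚ-congˡ {[]}     {b ∷ bs} q e = ≋-sym (≋[]⇒*ₚ≋[] (b ∷ bs) q (≋-sym e))
*ₚ-congˡ {a ∷ as} {[]}     q e = ≋[]⇒*ₚ≋[] (a ∷ as) q e
*ₚ-congˡ {a ∷ as} {b ∷ bs} q e =
  +ₚ-cong (·ₚ-cong (coeff≡ e 0) ≋-refl) (∷-cong refl (*ₚ-congˡ q (∷-injectiveʳ e)))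

*ₚ-congʳ : ∀ p {q q′} → q ≋ q′ → p *ₚ q ≋ p *ₚ q′
*ₚ-congʳ []       e = ≋-refl
*ₚ-congʳ (a ∷ as) e = +ₚ-cong (·ₚ-cong refl e) (∷-cong refl (*ₚ-congʳ as e))

*ₚ-cong : ∀ {p p′ q q′} → p ≋ p′ → q ≋ q′ → p *ₚ q ≋ p′ *ₚ q′
*ₚ-cong {p} {p′} {q} e f = ≋-trans (*ₚ-congˡ q e) (*ₚ-congʳ p′ f)

*ₚ-zeroʳ : ∀ p → p *ₚ [] ≋ []
*ₚ-zeroʳ []       = ≋-refl
*ₚ-zeroʳ (a ∷ as) = 0∷-≋[] (*ₚ-zeroʳ as)

*ₚ-distribʳ-+ₚ : ∀ r p q → (p +ₚ q) *ₚ r ≋ p *ₚ r +ₚ q *ₚ r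
*ₚ-distribʳ-+ₚ r []       q        = ≋-refl
*ₚ-distribʳ-+ₚ r (a ∷ as) []       = ≋-sym (+ₚ-identityʳ _)
*ₚ-distribʳ-+ₚ r (a ∷ as) (b ∷ bs) = begin
  (a ℚ.+ b) ·ₚ r +ₚ (0ℚ ∷ ((as +ₚ bs) *ₚ r))
    ≈⟨ +ₚ-cong (·ₚ-distribʳ-+ a b r) (∷-cong refl (*ₚ-distribʳ-+ₚ r as bs)) ⟩
  (a ·ₚ r +ₚ b ·ₚ r) +ₚ (0ℚ ∷ (as *ₚ r +ₚ bs *ₚ r))
    ≈⟨ +ₚ-cong ≋-refl (≋-sym (0∷-+ₚ (as *ₚ r) (bs *ₚ r))) ⟩
  (a ·ₚ r +ₚ b ·ₚ r) +ₚ ((0ℚ ∷ (as *ₚ r)) +ₚ (0ℚ ∷ (bs *ₚ r)))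
    ≈⟨ +ₚ-interchange (a ·ₚ r) (b ·ₚ r) (0ℚ ∷ (as *ₚ r)) (0ℚ ∷ (bs *ₚ r)) ⟩
  (a ·ₚ r +ₚ (0ℚ ∷ (as *ₚ r))) +ₚ (b ·ₚ r +ₚ (0ℚ ∷ (bs *ₚ r)))
    ∎
  where open ≋-Reasoning

*ₚ-distribˡ-+ₚ : ∀ r p q → r *ₚ (p +ₚ q) ≋ r *ₚ p +ₚ r *ₚ q
*ₚ-distribˡ-+ₚ []       p q = ≋-refl
*ₚ-distribˡ-+ₚ (a ∷ as) p q = begin
  a ·ₚ (p +ₚ q) +ₚ (0ℚ ∷ (as *ₚ (p +ₚ q)))
    ≈⟨ +ₚ-cong (·ₚ-distribˡ-+ₚ a p q) (∷-cong refl (*ₚ-distribˡ-+ₚ as p q)) ⟩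
  (a ·ₚ p +ₚ a ·ₚ q) +ₚ (0ℚ ∷ (as *ₚ p +ₚ as *ₚ q))
    ≈⟨ +ₚ-cong ≋-refl (≋-sym (0∷-+ₚ (as *ₚ p) (as *ₚ q))) ⟩
  (a ·ₚ p +ₚ a ·ₚ q) +ₚ ((0ℚ ∷ (as *ₚ p)) +ₚ (0ℚ ∷ (as *ₚ q)))
    ≈⟨ +ₚ-interchange (a ·ₚ p) (a ·ₚ q) (0ℚ ∷ (as *ₚ p)) (0ℚ ∷ (as *ₚ q)) ⟩
  (a ·ₚ p +ₚ (0ℚ ∷ (as *ₚ p))) +ₚ (a ·ₚ q +ₚ (0ℚ ∷ (as *ₚ q)))
    ∎
  where open ≋-Reasoning

·ₚ-*ₚ-assoc : ∀ c p q → (c ·ₚ p) *ₚ q ≋ c ·ₚ (p *ₚ q)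
·ₚ-*ₚ-assoc c []       q = ≋-refl
·ₚ-*ₚ-assoc c (a ∷ as) q = begin
  (c ℚ.* a) ·ₚ q +ₚ (0ℚ ∷ ((c ·ₚ as) *ₚ q))
    ≈⟨ +ₚ-cong (≋-sym (·ₚ-assoc c a q)) (∷-cong (sym (ℚP.*-zeroʳ c)) (·ₚ-*ₚ-assoc c as q)) ⟩
  c ·ₚ (a ·ₚ q) +ₚ c ·ₚ (0ℚ ∷ (as *ₚ q))
    ≈⟨ ·ₚ-distribˡ-+ₚ c (a ·ₚ q) (0ℚ ∷ (as *ₚ q)) ⟨
  c ·ₚ (a ·ₚ q +ₚ (0ℚ ∷ (as *ₚ q)))
    ∎
  where open ≋-Reasoning

0∷-*ₚ : ∀ p q → (0ℚ ∷ p) *ₚ q ≋ 0ℚ ∷ (p *ₚ q)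
0∷-*ₚ p q = +ₚ-cong (·ₚ-zero q) ≋-refl

*ₚ-0∷ : ∀ p q → p *ₚ (0ℚ ∷ q) ≋ 0ℚ ∷ (p *ₚ q)
*ₚ-0∷ []       q = ≋-sym (0∷-≋[] ≋-refl)
*ₚ-0∷ (a ∷ as) q = begin
  a ·ₚ (0ℚ ∷ q) +ₚ (0ℚ ∷ (as *ₚ (0ℚ ∷ q)))
    ≈⟨ +ₚ-cong (∷-cong (ℚP.*-zeroʳ a) ≋-refl) (∷-cong refl (*ₚ-0∷ as q)) ⟩
  (0ℚ ∷ (a ·ₚ q)) +ₚ (0ℚ ∷ (0ℚ ∷ (as *ₚ q)))
    ≈⟨ 0∷-+ₚ (a ·ₚ q) (0ℚ ∷ (as *ₚ q)) ⟩
  0ℚ ∷ (a ·ₚ q +ₚ (0ℚ ∷ (as *ₚ q)))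
    ∎
  where open ≋-Reasoning

*ₚ-constP : ∀ a q → q *ₚ constP a ≋ a ·ₚ q
*ₚ-constP a []       = ≋-refl
*ₚ-constP a (b ∷ bs) =
  ∷-cong (trans (ℚP.+-identityʳ _) (ℚP.*-comm b a)) (*ₚ-constP a bs)

*ₚ-comm : ∀ p q → p *ₚ q ≋ q *ₚ p
*ₚ-comm []       q = ≋-sym (*ₚ-zeroʳ q)
*ₚ-comm (a ∷ as) q = begin
  a ·ₚ q +ₚ (0ℚ ∷ (as *ₚ q))          ≈⟨ +ₚ-cong (≋-sym (*ₚ-constP a q)) (∷-cong refl (*ₚ-comm as q)) ⟩
  q *ₚ constP a +ₚ (0ℚ ∷ (q *ₚ as))   ≈⟨ +ₚ-cong ≋-refl (≋-sym (*ₚ-0∷ q as)) ⟩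
  q *ₚ constP a +ₚ q *ₚ (0ℚ ∷ as)     ≈⟨ *ₚ-distribˡ-+ₚ q (constP a) (0ℚ ∷ as) ⟨
  q *ₚ (constP a +ₚ (0ℚ ∷ as))        ≈⟨ *ₚ-congʳ q (∷-cong (ℚP.+-identityʳ a) ≋-refl) ⟩
  q *ₚ (a ∷ as)                       ∎
  where open ≋-Reasoning

*ₚ-assoc : ∀ p q r → (p *ₚ q) *ₚ r ≋ p *ₚ (q *ₚ r)
*ₚ-assoc []       q r = ≋-refl
*ₚ-assoc (a ∷ as) q r = begin
  (a ·ₚ q +ₚ (0ℚ ∷ (as *ₚ q))) *ₚ r
    ≈⟨ *ₚ-distribʳ-+ₚ r (a ·ₚ q) (0ℚ ∷ (as *ₚ q)) ⟩
  (a ·ₚ q) *ₚ r +ₚ (0ℚ ∷ (as *ₚ q)) *ₚ r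
    ≈⟨ +ₚ-cong (·ₚ-*ₚ-assoc a q r) (≋-trans (0∷-*ₚ (as *ₚ q) r) (∷-cong refl (*ₚ-assoc as q r))) ⟩
  a ·ₚ (q *ₚ r) +ₚ (0ℚ ∷ (as *ₚ (q *ₚ r)))
    ∎
  where open ≋-Reasoning

*ₚ-identityˡ : ∀ p → oneP *ₚ p ≋ p
*ₚ-identityˡ p = ≋-trans (+ₚ-cong (·ₚ-identity p) (0∷-≋[] ≋-refl)) (+ₚ-identityʳ p)

*ₚ-identityʳ : ∀ p → p *ₚ oneP ≋ p
*ₚ-identityʳ p = ≋-trans (*ₚ-comm p oneP) (*ₚ-identityˡ p)

·ₚ-as-*ₚ : ∀ c p → c ·ₚ p ≋ constP c *ₚ p
·ₚ-as-*ₚ c p = ≋-sym (≋-trans (+ₚ-cong ≋-refl (0∷-≋[] ≋-refl)) (+ₚ-identityʳ (c ·ₚ p)))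

constP-*ₚ : ∀ a b → constP (a ℚ.* b) ≋ constP a *ₚ constP b
constP-*ₚ a b = ∷-cong (sym (ℚP.+-identityʳ (a ℚ.* b))) ≋-refl

Poly-isCommutativeRing : IsCommutativeRing _≋_ _+ₚ_ _*ₚ_ negP [] oneP
Poly-isCommutativeRing = record
  { isRing = record
    { +-isAbelianGroup = record
      { isGroup = record
        { isMonoid = record
          { isSemigroup = record
            { isMagma = record { isEquivalence = ≋-isEquivalence ; ∙-cong = +ₚ-cong }
            ; assoc = +ₚ-assoc }
          ; identity = +ₚ-identityˡ , +ₚ-identityʳ }
        ; inverse = +ₚ-inverseˡ , +ₚ-inverseʳ
        ; ⁻¹-cong = negP-cong }
      ; comm = +ₚ-comm }
    ; *-cong = *ₚ-cong
    ; *-assoc = *ₚ-assoc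
    ; *-identity = *ₚ-identityˡ , *ₚ-identityʳ
    ; distrib = *ₚ-distribˡ-+ₚ , *ₚ-distribʳ-+ₚ }
  ; *-comm = *ₚ-comm }

Poly-commutativeRing : CommutativeRing _ _
Poly-commutativeRing = record { isCommutativeRing = Poly-isCommutativeRing }

constP-morphism : ℚ.+-*-rawRing ACR.-Raw-AlmostCommutative⟶ ACR.fromCommutativeRing Poly-commutativeRing
constP-morphism = record
  { ⟦_⟧    = constP
  ; +-homo = λ _ _ → ≋-refl
  ; *-homo = constP-*ₚ
  ; -‿homo = λ a → ∷-cong (trans (cong ℚ.-_ (sym (ℚP.*-identityˡ a))) (ℚP.neg-distribˡ-* 1ℚ a)) ≋-refl
  ; 0-homo = 0∷-≋[] ≋-refl
  ; 1-homo = ≋-refl }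

constP-≋? : ∀ a b → Maybe (constP a ≋ constP b)
constP-≋? a b with a ℚP.≟ b
... | yes e = just (∷-cong e ≋-refl)
... | no _  = nothing

module PolySolver = RingSolver ℚ.+-*-rawRing (ACR.fromCommutativeRing Poly-commutativeRing) constP-morphism constP-≋?

ι-toℚᵘ : ∀ z → ℚ.toℚᵘ (ι z) ℚᵘ.≃ ℚᵘ.mkℚᵘ z 0
ι-toℚᵘ z = ℚP.toℚᵘ-fromℚᵘ (ℚᵘ.mkℚᵘ z 0)

ι-+ : ∀ a b → ι (a ℤ.+ b) ≡ ι a ℚ.+ ι b
ι-+ a b = ℚP.toℚᵘ-injective (begin
  ℚ.toℚᵘ (ι (a ℤ.+ b))                    ≈⟨ ι-toℚᵘ (a ℤ.+ b) ⟩
  ℚᵘ.mkℚᵘ (a ℤ.+ b) 0                     ≈⟨ ℚᵘ.*≡* (cong (ℤ._* + 1) (sym (cong₂ ℤ._+_ (ℤP.*-identityʳ a) (ℤP.*-identityʳ b)))) ⟩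
  ℚᵘ.mkℚᵘ a 0 ℚᵘ.+ ℚᵘ.mkℚᵘ b 0            ≈⟨ ℚᵘP.+-cong (ι-toℚᵘ a) (ι-toℚᵘ b) ⟨
  ℚ.toℚᵘ (ι a) ℚᵘ.+ ℚ.toℚᵘ (ι b)          ≈⟨ ℚP.toℚᵘ-homo-+ (ι a) (ι b) ⟨
  ℚ.toℚᵘ (ι a ℚ.+ ι b)                    ∎)
  where open ℚᵘP.≃-Reasoning

ι-* : ∀ a b → ι (a ℤ.* b) ≡ ι a ℚ.* ι b
ι-* a b = ℚP.toℚᵘ-injective (begin
  ℚ.toℚᵘ (ι (a ℤ.* b))                    ≈⟨ ι-toℚᵘ (a ℤ.* b) ⟩
  ℚᵘ.mkℚᵘ a 0 ℚᵘ.* ℚᵘ.mkℚᵘ b 0            ≈⟨ ℚᵘP.*-cong (ι-toℚᵘ a) (ι-toℚᵘ b) ⟨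
  ℚ.toℚᵘ (ι a) ℚᵘ.* ℚ.toℚᵘ (ι b)          ≈⟨ ℚP.toℚᵘ-homo-* (ι a) (ι b) ⟨
  ℚ.toℚᵘ (ι a ℚ.* ι b)                    ∎)
  where open ℚᵘP.≃-Reasoning

ι-pos-* : ∀ m n → ι (+ (m * n)) ≡ ι (+ m) ℚ.* ι (+ n)
ι-pos-* m n = trans (cong ι (ℤP.pos-* m n)) (ι-* (+ m) (+ n))

ι-neg : ∀ a → ι (ℤ.- a) ≡ ℚ.- ι a
ι-neg a = ℚP.toℚᵘ-injective (begin
  ℚ.toℚᵘ (ι (ℤ.- a))                      ≈⟨ ι-toℚᵘ (ℤ.- a) ⟩
  ℚᵘ.- ℚᵘ.mkℚᵘ a 0                        ≈⟨ ℚᵘP.-‿cong (ι-toℚᵘ a) ⟨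
  ℚᵘ.- ℚ.toℚᵘ (ι a)                       ≈⟨ ℚP.toℚᵘ-homo‿- (ι a) ⟨
  ℚ.toℚᵘ (ℚ.- ι a)                        ∎)
  where open ℚᵘP.≃-Reasoning

ι-injective : ∀ {a b} → ι a ≡ ι b → a ≡ b
ι-injective {a} {b} e
  with ℚᵘP.≃-trans (ℚᵘP.≃-sym (ι-toℚᵘ a)) (ℚᵘP.≃-trans (ℚP.toℚᵘ-cong e) (ι-toℚᵘ b))
... | ℚᵘ.*≡* eq = trans (sym (ℤP.*-identityʳ a)) (trans eq (ℤP.*-identityʳ b))

ι≢0 : ∀ {z} → z ≢ + 0 → ι z ≢ 0ℚ
ι≢0 z≢0 e = z≢0 (ι-injective e)

ι-pos≢0 : ∀ {n} → n ≢ 0 → ι (+ n) ≢ 0ℚ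
ι-pos≢0 n≢0 = ι≢0 (λ e → n≢0 (ℤP.+-injective e))

coeff-derivAux : ∀ k p n → coeff (derivAux k p) n ≡ ι (+ (k + n)) ℚ.* coeff p n
coeff-derivAux k []       n       = sym (ℚP.*-zeroʳ (ι (+ (k + n))))
coeff-derivAux k (a ∷ as) zero    = cong (λ j → ι (+ j) ℚ.* a) (sym (ℕP.+-identityʳ k))
coeff-derivAux k (a ∷ as) (suc n) =
  trans (coeff-derivAux (suc k) as n) (cong (λ j → ι (+ j) ℚ.* coeff as n) (sym (ℕP.+-suc k n)))

coeff-deriv : ∀ p n → coeff (deriv p) n ≡ ι (+ suc n) ℚ.* coeff p (suc n)
coeff-deriv []       n = sym (ℚP.*-zeroʳ (ι (+ suc n)))
coeff-deriv (a ∷ as) n = coeff-derivAux 1 as n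

deriv-cong : ∀ {p q} → p ≋ q → deriv p ≋ deriv q
deriv-cong {p} {q} e = mk≋ λ n → begin
  coeff (deriv p) n                    ≡⟨ coeff-deriv p n ⟩
  ι (+ suc n) ℚ.* coeff p (suc n)      ≡⟨ cong (ι (+ suc n) ℚ.*_) (coeff≡ e (suc n)) ⟩
  ι (+ suc n) ℚ.* coeff q (suc n)      ≡⟨ coeff-deriv q n ⟨
  coeff (deriv q) n                    ∎
  where open ≡-Reasoning

deriv-+ₚ : ∀ p q → deriv (p +ₚ q) ≋ deriv p +ₚ deriv q
deriv-+ₚ p q = mk≋ λ n → begin
  coeff (deriv (p +ₚ q)) n
    ≡⟨ coeff-deriv (p +ₚ q) n ⟩
  ι (+ suc n) ℚ.* coeff (p +ₚ q) (suc n)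
    ≡⟨ cong (ι (+ suc n) ℚ.*_) (coeff-+ₚ p q (suc n)) ⟩
  ι (+ suc n) ℚ.* (coeff p (suc n) ℚ.+ coeff q (suc n))
    ≡⟨ ℚP.*-distribˡ-+ (ι (+ suc n)) (coeff p (suc n)) (coeff q (suc n)) ⟩
  ι (+ suc n) ℚ.* coeff p (suc n) ℚ.+ ι (+ suc n) ℚ.* coeff q (suc n)
    ≡⟨ cong₂ ℚ._+_ (coeff-deriv p n) (coeff-deriv q n) ⟨
  coeff (deriv p) n ℚ.+ coeff (deriv q) n
    ≡⟨ coeff-+ₚ (deriv p) (deriv q) n ⟨
  coeff (deriv p +ₚ deriv q) n
    ∎
  where open ≡-Reasoning

deriv-·ₚ : ∀ c p → deriv (c ·ₚ p) ≋ c ·ₚ deriv p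
deriv-·ₚ c p = mk≋ λ n → begin
  coeff (deriv (c ·ₚ p)) n                    ≡⟨ coeff-deriv (c ·ₚ p) n ⟩
  ι (+ suc n) ℚ.* coeff (c ·ₚ p) (suc n)      ≡⟨ cong (ι (+ suc n) ℚ.*_) (coeff-·ₚ c p (suc n)) ⟩
  ι (+ suc n) ℚ.* (c ℚ.* coeff p (suc n))     ≡⟨ ℚP.*-assoc (ι (+ suc n)) c (coeff p (suc n)) ⟨
  (ι (+ suc n) ℚ.* c) ℚ.* coeff p (suc n)     ≡⟨ cong (ℚ._* coeff p (suc n)) (ℚP.*-comm (ι (+ suc n)) c) ⟩
  (c ℚ.* ι (+ suc n)) ℚ.* coeff p (suc n)     ≡⟨ ℚP.*-assoc c (ι (+ suc n)) (coeff p (suc n)) ⟩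
  c ℚ.* (ι (+ suc n) ℚ.* coeff p (suc n))     ≡⟨ cong (c ℚ.*_) (coeff-deriv p n) ⟨
  c ℚ.* coeff (deriv p) n                     ≡⟨ coeff-·ₚ c (deriv p) n ⟨
  coeff (c ·ₚ deriv p) n                      ∎
  where open ≡-Reasoning

deriv--ₚ : ∀ p q → deriv (p -ₚ q) ≋ deriv p -ₚ deriv q
deriv--ₚ p q = ≋-trans (deriv-+ₚ p (negP q)) (+ₚ-cong ≋-refl (deriv-·ₚ (ℚ.- 1ℚ) q))

0∷-as-XP : ∀ p → 0ℚ ∷ p ≋ XP *ₚ p
0∷-as-XP p = ≋-sym (+ₚ-cong (·ₚ-zero p) (∷-cong refl (*ₚ-identityˡ p)))

deriv-0∷ : ∀ p → deriv (0ℚ ∷ p) ≋ p +ₚ (0ℚ ∷ deriv p)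
deriv-0∷ p = mk≋ λ n → trans (coeff-deriv (0ℚ ∷ p) n) (trans (coeff-step n) (sym (coeff-+ₚ p (0ℚ ∷ deriv p) n)))
  where
  open ≡-Reasoning
  coeff-step : ∀ n → ι (+ suc n) ℚ.* coeff p n ≡ coeff p n ℚ.+ coeff (0ℚ ∷ deriv p) n
  coeff-step zero    = trans (ℚP.*-identityˡ (coeff p 0)) (sym (ℚP.+-identityʳ (coeff p 0)))
  coeff-step (suc m) = begin
    ι (+ suc (suc m)) ℚ.* coeff p (suc m)                           ≡⟨ cong (ℚ._* coeff p (suc m)) (ι-+ (+ 1) (+ suc m)) ⟩
    (1ℚ ℚ.+ ι (+ suc m)) ℚ.* coeff p (suc m)                        ≡⟨ ℚP.*-distribʳ-+ (coeff p (suc m)) 1ℚ (ι (+ suc m)) ⟩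
    1ℚ ℚ.* coeff p (suc m) ℚ.+ ι (+ suc m) ℚ.* coeff p (suc m)      ≡⟨ cong₂ ℚ._+_ (ℚP.*-identityˡ (coeff p (suc m))) (sym (coeff-deriv p m)) ⟩
    coeff p (suc m) ℚ.+ coeff (deriv p) m                           ∎

deriv-*ₚ : ∀ p q → deriv (p *ₚ q) ≋ deriv p *ₚ q +ₚ p *ₚ deriv q
deriv-*ₚ []       q = ≋-refl
deriv-*ₚ (a ∷ as) q = begin
  deriv (a ·ₚ q +ₚ (0ℚ ∷ (as *ₚ q)))
    ≈⟨ deriv-+ₚ (a ·ₚ q) (0ℚ ∷ (as *ₚ q)) ⟩
  deriv (a ·ₚ q) +ₚ deriv (0ℚ ∷ (as *ₚ q))
    ≈⟨ +ₚ-cong (≋-trans (deriv-·ₚ a q) (·ₚ-as-*ₚ a (deriv q)))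
               (≋-trans (deriv-0∷ (as *ₚ q)) (+ₚ-cong ≋-refl (≋-trans (0∷-as-XP _) (*ₚ-congʳ XP (deriv-*ₚ as q))))) ⟩
  A *ₚ deriv q +ₚ (as *ₚ q +ₚ XP *ₚ (deriv as *ₚ q +ₚ as *ₚ deriv q))
    ≈⟨ solve 6 (λ A Q Q′ S S′ X → A :* Q′ :+ (S :* Q :+ X :* (S′ :* Q :+ S :* Q′))
                              := (S :+ X :* S′) :* Q :+ (A :* Q′ :+ X :* (S :* Q′)))
               ≋-refl A q (deriv q) as (deriv as) XP ⟩
  (as +ₚ XP *ₚ deriv as) *ₚ q +ₚ (A *ₚ deriv q +ₚ XP *ₚ (as *ₚ deriv q))
    ≈⟨ +ₚ-cong (*ₚ-congˡ q (≋-sym (≋-trans (deriv-0∷ as) (+ₚ-cong ≋-refl (0∷-as-XP _)))))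
               (+ₚ-cong (≋-sym (·ₚ-as-*ₚ a (deriv q))) (≋-sym (0∷-as-XP _))) ⟩
  deriv (0ℚ ∷ as) *ₚ q +ₚ (a ·ₚ deriv q +ₚ (0ℚ ∷ (as *ₚ deriv q)))
    ∎
  where
  open ≋-Reasoning
  open PolySolver
  A = constP a

recip : (c : ℚ) → c ≢ 0ℚ → ℚ
recip c c≢0 = (ℚ.1/ c) {{ℚ.≢-nonZero c≢0}}

recip-inverseˡ : ∀ c (c≢0 : c ≢ 0ℚ) → recip c c≢0 ℚ.* c ≡ 1ℚ
recip-inverseˡ c c≢0 = ℚP.*-inverseˡ c {{ℚ.≢-nonZero c≢0}}

recip-inverseʳ : ∀ c (c≢0 : c ≢ 0ℚ) → c ℚ.* recip c c≢0 ≡ 1ℚ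
recip-inverseʳ c c≢0 = ℚP.*-inverseʳ c {{ℚ.≢-nonZero c≢0}}

*-≢0 : ∀ {a b} → a ≢ 0ℚ → b ≢ 0ℚ → a ℚ.* b ≢ 0ℚ
*-≢0 {a} {b} a≢0 b≢0 ab≡0 = b≢0 (begin
  b                                  ≡⟨ ℚP.*-identityˡ b ⟨
  1ℚ ℚ.* b                           ≡⟨ cong (ℚ._* b) (recip-inverseˡ a a≢0) ⟨
  (recip a a≢0 ℚ.* a) ℚ.* b          ≡⟨ ℚP.*-assoc (recip a a≢0) a b ⟩
  recip a a≢0 ℚ.* (a ℚ.* b)          ≡⟨ cong (recip a a≢0 ℚ.*_) ab≡0 ⟩
  recip a a≢0 ℚ.* 0ℚ                 ≡⟨ ℚP.*-zeroʳ (recip a a≢0) ⟩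
  0ℚ                                 ∎)
  where open ≡-Reasoning

recip-≢0 : ∀ c (c≢0 : c ≢ 0ℚ) → recip c c≢0 ≢ 0ℚ
recip-≢0 c c≢0 e = ℚP.1≢0 (trans (sym (recip-inverseˡ c c≢0)) (trans (cong (ℚ._* c) e) (ℚP.*-zeroˡ c)))

recip-·ₚ-cancel : ∀ c (c≢0 : c ≢ 0ℚ) p → recip c c≢0 ·ₚ (c ·ₚ p) ≋ p
recip-·ₚ-cancel c c≢0 p = ≋-trans (·ₚ-assoc _ c p) (≋-trans (·ₚ-cong (recip-inverseˡ c c≢0) ≋-refl) (·ₚ-identity p))

DegreeBelow : Poly → ℕ → Set
DegreeBelow p n = ∀ m → n ≤ m → coeff p m ≡ 0ℚ

DegreeBelow-mono : ∀ {p n n′} → n ≤ n′ → DegreeBelow p n → DegreeBelow p n′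
DegreeBelow-mono n≤n′ d m n′≤m = d m (ℕP.≤-trans n≤n′ n′≤m)

DegreeBelow-≋ : ∀ {p q n} → p ≋ q → DegreeBelow p n → DegreeBelow q n
DegreeBelow-≋ e d m n≤m = trans (sym (coeff≡ e m)) (d m n≤m)

DegreeBelow-+ₚ : ∀ {p q n} → DegreeBelow p n → DegreeBelow q n → DegreeBelow (p +ₚ q) n
DegreeBelow-+ₚ {p} {q} dp dq m n≤m =
  trans (coeff-+ₚ p q m) (trans (cong₂ ℚ._+_ (dp m n≤m) (dq m n≤m)) (ℚP.+-identityˡ 0ℚ))

DegreeBelow-·ₚ : ∀ {c p n} → DegreeBelow p n → DegreeBelow (c ·ₚ p) n
DegreeBelow-·ₚ {c} {p} dp m n≤m = trans (coeff-·ₚ c p m) (trans (cong (c ℚ.*_) (dp m n≤m)) (ℚP.*-zeroʳ c))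

DegreeBelow-length : ∀ p → DegreeBelow p (length p)
DegreeBelow-length []      m       _         = refl
DegreeBelow-length (a ∷ p) (suc m) (s≤s n≤m) = DegreeBelow-length p m n≤m

leading-*ₚ : ∀ p q i j → DegreeBelow p (suc i) → DegreeBelow q (suc j) →
             DegreeBelow (p *ₚ q) (suc (i + j)) × coeff (p *ₚ q) (i + j) ≡ coeff p i ℚ.* coeff q j
leading-*ₚ []       q i       j dp dq = (λ _ _ → refl) , sym (ℚP.*-zeroˡ (coeff q j))
leading-*ₚ (a ∷ as) q zero    j dp dq = below , top
  where
  as≋[] : as ≋ []
  as≋[] = mk≋ λ m → dp (suc m) (s≤s z≤n)
  p*q≋a·q : (a ∷ as) *ₚ q ≋ a ·ₚ q
  p*q≋a·q = ≋-trans (+ₚ-cong ≋-refl (0∷-≋[] (≋[]⇒*ₚ≋[] as q as≋[]))) (+ₚ-identityʳ (a ·ₚ q))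
  below : DegreeBelow ((a ∷ as) *ₚ q) (suc j)
  below = DegreeBelow-≋ (≋-sym p*q≋a·q) (DegreeBelow-·ₚ {a} {q} dq)
  top : coeff ((a ∷ as) *ₚ q) j ≡ a ℚ.* coeff q j
  top = trans (coeff≡ p*q≋a·q j) (coeff-·ₚ a q j)
leading-*ₚ (a ∷ as) q (suc i) j dp dq = below , top
  where
  ih = leading-*ₚ as q i j (λ m le → dp (suc m) (s≤s le)) dq
  a·q-vanishes : ∀ m → suc i + j ≤ m → coeff (a ·ₚ q) m ≡ 0ℚ
  a·q-vanishes m le = DegreeBelow-·ₚ {a} {q} dq m (ℕP.≤-trans (s≤s (ℕP.m≤n+m j i)) le)
  below : DegreeBelow ((a ∷ as) *ₚ q) (suc (suc i + j))
  below (suc m) (s≤s le) = begin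
    coeff (a ·ₚ q +ₚ (0ℚ ∷ (as *ₚ q))) (suc m)          ≡⟨ coeff-+ₚ (a ·ₚ q) _ (suc m) ⟩
    coeff (a ·ₚ q) (suc m) ℚ.+ coeff (as *ₚ q) m        ≡⟨ cong₂ ℚ._+_ (a·q-vanishes (suc m) (ℕP.m≤n⇒m≤1+n le)) (proj₁ ih m le) ⟩
    0ℚ                                                  ∎
    where open ≡-Reasoning
  top : coeff ((a ∷ as) *ₚ q) (suc i + j) ≡ coeff as i ℚ.* coeff q j
  top = begin
    coeff (a ·ₚ q +ₚ (0ℚ ∷ (as *ₚ q))) (suc (i + j))     ≡⟨ coeff-+ₚ (a ·ₚ q) _ (suc (i + j)) ⟩
    coeff (a ·ₚ q) (suc (i + j)) ℚ.+ coeff (as *ₚ q) (i + j)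
                                                         ≡⟨ cong (ℚ._+ _) (a·q-vanishes (suc (i + j)) ℕP.≤-refl) ⟩
    0ℚ ℚ.+ coeff (as *ₚ q) (i + j)                       ≡⟨ ℚP.+-identityˡ _ ⟩
    coeff (as *ₚ q) (i + j)                              ≡⟨ proj₂ ih ⟩
    coeff as i ℚ.* coeff q j                             ∎
    where open ≡-Reasoning

-- Degree p n is HasDegree p n as a record, so that p and n can be inferred.
record Degree (p : Poly) (n : ℕ) : Set where
  constructor mkDegree
  field
    lead≢0 : coeff p n ≢ 0ℚ
    above  : DegreeBelow p (suc n)

degree-or-zero : ∀ p → p ≋ [] ⊎ Σ ℕ (Degree p)
degree-or-zero [] = inj₁ ≋-refl
degree-or-zero (a ∷ as) with degree-or-zero as
... | inj₂ (n , mkDegree lead≢0 above) = inj₂ (suc n , mkDegree lead≢0 λ { (suc m) (s≤s le) → above m le })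
... | inj₁ as≋[] with a ℚP.≟ 0ℚ
...   | yes a≡0 = inj₁ (mk≋ λ { zero → a≡0 ; (suc m) → coeff≡ as≋[] m })
...   | no  a≢0 = inj₂ (0 , mkDegree a≢0 λ { (suc m) _ → coeff≡ as≋[] m })

Degree-≋ : ∀ {p q n} → p ≋ q → Degree p n → Degree q n
Degree-≋ e (mkDegree lead≢0 above) = mkDegree (λ l≡0 → lead≢0 (trans (coeff≡ e _) l≡0)) (DegreeBelow-≋ e above)

Degree-unique : ∀ {p m n} → Degree p m → Degree p n → m ≡ n
Degree-unique {m = m} {n} (mkDegree lead≢0 above) (mkDegree lead′≢0 above′) with ℕP.<-cmp m n
... | tri< m<n _ _ = ⊥-elim (lead′≢0 (above n m<n))
... | tri≈ _ m≡n _ = m≡n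
... | tri> _ _ n<m = ⊥-elim (lead≢0 (above′ m n<m))

Degree⇒≉[] : ∀ {p n} → Degree p n → ¬ p ≋ []
Degree⇒≉[] (mkDegree lead≢0 _) p≋[] = lead≢0 (coeff≡ p≋[] _)

Degree-*ₚ : ∀ {p q i j} → Degree p i → Degree q j → Degree (p *ₚ q) (i + j)
Degree-*ₚ {p} {q} {i} {j} (mkDegree lead≢0 above) (mkDegree lead′≢0 above′) =
  mkDegree (λ e → *-≢0 lead≢0 lead′≢0 (trans (sym top) e)) below
  where
  below = proj₁ (leading-*ₚ p q i j above above′)
  top   = proj₂ (leading-*ₚ p q i j above above′)

Degree-cofactor : ∀ p {q n} → Degree (p *ₚ q) n → Σ ℕ (Degree q)
Degree-cofactor p {q} dpq with degree-or-zero q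
... | inj₁ q≋[] = ⊥-elim (Degree⇒≉[] dpq (≋-trans (*ₚ-comm p q) (≋[]⇒*ₚ≋[] q p q≋[])))
... | inj₂ dq   = dq

coeff-*ₚ-leading : ∀ {p q i j} → Degree p i → Degree q j → coeff (p *ₚ q) (i + j) ≡ coeff p i ℚ.* coeff q j
coeff-*ₚ-leading {p} {q} {i} {j} dp dq = proj₂ (leading-*ₚ p q i j (Degree.above dp) (Degree.above dq))

Degree-·ₚ : ∀ {c p n} → c ≢ 0ℚ → Degree p n → Degree (c ·ₚ p) n
Degree-·ₚ {c} {p} {n} c≢0 (mkDegree lead≢0 above) =
  mkDegree (λ e → *-≢0 c≢0 lead≢0 (trans (sym (coeff-·ₚ c p n)) e)) (DegreeBelow-·ₚ {c} {p} above)

Degree-+ₚ-lower : ∀ {f g n} → DegreeBelow g n → Degree f n →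
                     Degree (g +ₚ f) n × coeff (g +ₚ f) n ≡ coeff f n
Degree-+ₚ-lower {f} {g} {n} dg (mkDegree lead≢0 above) =
  mkDegree (λ e → lead≢0 (trans (sym top) e)) (DegreeBelow-+ₚ {g} {f} (DegreeBelow-mono {g} (ℕP.n≤1+n n) dg) above) , top
  where
  top : coeff (g +ₚ f) n ≡ coeff f n
  top = trans (coeff-+ₚ g f n) (trans (cong (ℚ._+ coeff f n) (dg n ℕP.≤-refl)) (ℚP.+-identityˡ (coeff f n)))

IsConst⇒≋constP : ∀ {p} → IsConst p → p ≋ constP (coeff p 0)
IsConst⇒≋constP c = mk≋ λ { zero → refl ; (suc m) → c (suc m) (s≤s z≤n) }

≋[]⇒IsConst : ∀ {p} → p ≋ [] → IsConst p
≋[]⇒IsConst p≋[] k _ = coeff≡ p≋[] k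

Degree-zero⇒≋constP : ∀ {p} → Degree p 0 → p ≋ constP (coeff p 0)
Degree-zero⇒≋constP (mkDegree _ above) = IsConst⇒≋constP above

Degree-suc⇒¬IsConst : ∀ {p k} → Degree p (suc k) → ¬ IsConst p
Degree-suc⇒¬IsConst (mkDegree lead≢0 _) c = lead≢0 (c _ (s≤s z≤n))

¬IsConst⇒Degree-suc : ∀ {p} → ¬ IsConst p → Σ ℕ λ k → Degree p (suc k)
¬IsConst⇒Degree-suc {p} nc with degree-or-zero p
... | inj₁ p≋[]          = ⊥-elim (nc (≋[]⇒IsConst p≋[]))
... | inj₂ (zero  , mkDegree _ above) = ⊥-elim (nc above)
... | inj₂ (suc k , d)   = k , d

ι-suc≢0 : ∀ k → ι (+ suc k) ≢ 0ℚ
ι-suc≢0 k = ι-pos≢0 {suc k} (λ ())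

Degree-deriv : ∀ {p k} → Degree p (suc k) → Degree (deriv p) k
Degree-deriv {p} {k} (mkDegree lead≢0 above) = mkDegree
  (λ e → *-≢0 (ι-suc≢0 k) lead≢0 (trans (sym (coeff-deriv p k)) e))
  (λ m k<m → trans (coeff-deriv p m) (trans (cong (ι (+ suc m) ℚ.*_) (above (suc m) (s≤s k<m))) (ℚP.*-zeroʳ (ι (+ suc m)))))

monomial : ℚ → ℕ → Poly
monomial c zero    = constP c
monomial c (suc j) = 0ℚ ∷ monomial c j

coeff-monomial : ∀ c j → coeff (monomial c j) j ≡ c
coeff-monomial c zero    = refl
coeff-monomial c (suc j) = coeff-monomial c j

DegreeBelow-monomial : ∀ c j → DegreeBelow (monomial c j) (suc j)
DegreeBelow-monomial c zero    (suc m) _         = refl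
DegreeBelow-monomial c (suc j) (suc m) (s≤s le)  = DegreeBelow-monomial c j m le

monomial-*ₚ-leading : ∀ c j {g k} → Degree g k →
  DegreeBelow (monomial c j *ₚ g) (suc (j + k)) × coeff (monomial c j *ₚ g) (j + k) ≡ c ℚ.* coeff g k
monomial-*ₚ-leading c j {g} {k} (mkDegree _ above) =
  proj₁ lt , trans (proj₂ lt) (cong (ℚ._* coeff g k) (coeff-monomial c j))
  where lt = leading-*ₚ (monomial c j) g j k (DegreeBelow-monomial c j) above

cancel-leading : ∀ {f g k n} (dg : Degree g k) → k ≤ n → DegreeBelow f (suc n) →
  DegreeBelow (f -ₚ monomial (coeff f n ℚ.* recip (coeff g k) (Degree.lead≢0 dg)) (n ∸ k) *ₚ g) n
cancel-leading {f} {g} {k} {n} dg@(mkDegree lead≢0 _) k≤n df m n≤m =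
  trans (coeff--ₚ f t*g m) (vanish (ℕP.m≤n⇒m<n∨m≡n n≤m))
  where
  open ≡-Reasoning
  c   = coeff f n ℚ.* recip (coeff g k) lead≢0
  t*g = monomial c (n ∸ k) *ₚ g
  lt : DegreeBelow t*g (suc n) × coeff t*g n ≡ c ℚ.* coeff g k
  lt = subst (λ x → DegreeBelow t*g (suc x) × coeff t*g x ≡ c ℚ.* coeff g k)
             (ℕP.m∸n+n≡m k≤n) (monomial-*ₚ-leading c (n ∸ k) dg)
  top : coeff t*g n ≡ coeff f n
  top = begin
    coeff t*g n                                              ≡⟨ proj₂ lt ⟩
    c ℚ.* coeff g k                                          ≡⟨ ℚP.*-assoc (coeff f n) _ (coeff g k) ⟩
    coeff f n ℚ.* (recip (coeff g k) lead≢0 ℚ.* coeff g k)   ≡⟨ cong (coeff f n ℚ.*_) (recip-inverseˡ (coeff g k) lead≢0) ⟩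
    coeff f n ℚ.* 1ℚ                                         ≡⟨ ℚP.*-identityʳ (coeff f n) ⟩
    coeff f n                                                ∎
  vanish : n < m ⊎ n ≡ m → coeff f m ℚ.- coeff t*g m ≡ 0ℚ
  vanish (inj₁ n<m)  = cong₂ ℚ._-_ (df m n<m) (proj₁ lt m n<m)
  vanish (inj₂ refl) = trans (cong (λ x → coeff f n ℚ.- x) top) (ℚP.+-inverseʳ (coeff f n))

record DivMod (f g : Poly) (k : ℕ) : Set where
  field
    quotient remainder : Poly
    f≋                 : f ≋ quotient *ₚ g +ₚ remainder
    remainder-degree   : DegreeBelow remainder k

divMod : ∀ n f g k → Degree g k → DegreeBelow f n → DivMod f g k
divMod zero    f g k dg df = record { quotient = [] ; remainder = f ; f≋ = ≋-refl ; remainder-degree = DegreeBelow-mono {f} z≤n df }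
divMod (suc n) f g k dg df with k ℕP.≤? n
... | no  k≰n = record { quotient = [] ; remainder = f ; f≋ = ≋-refl ; remainder-degree = DegreeBelow-mono {f} (ℕP.≰⇒> k≰n) df }
... | yes k≤n = record { quotient = q +ₚ t ; remainder = r ; f≋ = f≋ ; remainder-degree = DivMod.remainder-degree rec }
  where
  t   = monomial (coeff f n ℚ.* recip (coeff g k) (Degree.lead≢0 dg)) (n ∸ k)
  rec = divMod n (f -ₚ t *ₚ g) g k dg (cancel-leading {f} dg k≤n df)
  q   = DivMod.quotient rec
  r   = DivMod.remainder rec
  f≋ : f ≋ (q +ₚ t) *ₚ g +ₚ r
  f≋ = begin
    f                                ≈⟨ solve 3 (λ F T G → F := (F :- T :* G) :+ T :* G) ≋-refl f t g ⟩
    (f -ₚ t *ₚ g) +ₚ t *ₚ g          ≈⟨ +ₚ-cong (DivMod.f≋ rec) ≋-refl ⟩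
    (q *ₚ g +ₚ r) +ₚ t *ₚ g          ≈⟨ solve 4 (λ Q R T G → (Q :* G :+ R) :+ T :* G := (Q :+ T) :* G :+ R) ≋-refl q r t g ⟩
    (q +ₚ t) *ₚ g +ₚ r               ∎
    where
    open ≋-Reasoning
    open PolySolver

infix 4 _∣ₚ_
_∣ₚ_ : Poly → Poly → Set
d ∣ₚ f = Σ Poly λ s → f ≋ d *ₚ s

record GCD (f g : Poly) : Set where
  field
    gcd u v : Poly
    bezout  : u *ₚ f +ₚ v *ₚ g ≋ gcd
    gcd∣f   : gcd ∣ₚ f
    gcd∣g   : gcd ∣ₚ g

euclid : ∀ n f g → DegreeBelow g n → GCD f g
euclid n f g g<n with degree-or-zero g
... | inj₁ g≋[] = record
  { gcd = f ; u = oneP ; v = []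
  ; bezout = ≋-trans (+ₚ-identityʳ (oneP *ₚ f)) (*ₚ-identityˡ f)
  ; gcd∣f = oneP , ≋-sym (*ₚ-identityʳ f)
  ; gcd∣g = [] , ≋-trans g≋[] (≋-sym (*ₚ-zeroʳ f)) }
euclid zero    f g g<0 | inj₂ (k , mkDegree lead≢0 _) = ⊥-elim (lead≢0 (g<0 k z≤n))
euclid (suc n) f g g<n | inj₂ (k , dg) = record
  { gcd = d ; u = v′ ; v = u′ -ₚ v′ *ₚ q ; bezout = bezout
  ; gcd∣f = q *ₚ s₁ +ₚ s₂ , d∣f ; gcd∣g = s₁ , g≋ds₁ }
  where
  k≤n : k ≤ n
  k≤n with k ℕP.≤? n
  ... | yes k≤n = k≤n
  ... | no  k≰n = ⊥-elim (Degree.lead≢0 dg (g<n k (ℕP.≰⇒> k≰n)))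
  qr  = divMod (length f) f g k dg (DegreeBelow-length f)
  q   = DivMod.quotient qr
  r   = DivMod.remainder qr
  rec = euclid n g r (DegreeBelow-mono {r} k≤n (DivMod.remainder-degree qr))
  d   = GCD.gcd rec
  u′  = GCD.u rec
  v′  = GCD.v rec
  s₁  = proj₁ (GCD.gcd∣f rec)
  g≋ds₁ = proj₂ (GCD.gcd∣f rec)
  s₂  = proj₁ (GCD.gcd∣g rec)
  open ≋-Reasoning
  open PolySolver
  bezout : v′ *ₚ f +ₚ (u′ -ₚ v′ *ₚ q) *ₚ g ≋ d
  bezout = begin
    v′ *ₚ f +ₚ (u′ -ₚ v′ *ₚ q) *ₚ g          ≈⟨ +ₚ-cong (*ₚ-congʳ v′ (DivMod.f≋ qr)) ≋-refl ⟩
    v′ *ₚ (q *ₚ g +ₚ r) +ₚ (u′ -ₚ v′ *ₚ q) *ₚ g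
      ≈⟨ solve 5 (λ V U Q G R → V :* (Q :* G :+ R) :+ (U :- V :* Q) :* G := U :* G :+ V :* R) ≋-refl v′ u′ q g r ⟩
    u′ *ₚ g +ₚ v′ *ₚ r                      ≈⟨ GCD.bezout rec ⟩
    d                                       ∎
  d∣f : f ≋ d *ₚ (q *ₚ s₁ +ₚ s₂)
  d∣f = begin
    f                                ≈⟨ DivMod.f≋ qr ⟩
    q *ₚ g +ₚ r                      ≈⟨ +ₚ-cong (*ₚ-congʳ q g≋ds₁) (proj₂ (GCD.gcd∣g rec)) ⟩
    q *ₚ (d *ₚ s₁) +ₚ d *ₚ s₂        ≈⟨ solve 4 (λ Q D S₁ S₂ → Q :* (D :* S₁) :+ D :* S₂ := D :* (Q :* S₁ :+ S₂)) ≋-refl q d s₁ s₂ ⟩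
    d *ₚ (q *ₚ s₁ +ₚ s₂)             ∎

gcdₚ : ∀ f g → GCD f g
gcdₚ f g = euclid (length g) f g (DegreeBelow-length g)

*ₚ-·ₚ-comm : ∀ c p q → p *ₚ (c ·ₚ q) ≋ c ·ₚ (p *ₚ q)
*ₚ-·ₚ-comm c p q = begin
  p *ₚ (c ·ₚ q)             ≈⟨ *ₚ-congʳ p (·ₚ-as-*ₚ c q) ⟩
  p *ₚ (constP c *ₚ q)      ≈⟨ solve 3 (λ P C Q → P :* (C :* Q) := C :* (P :* Q)) ≋-refl p (constP c) q ⟩
  constP c *ₚ (p *ₚ q)      ≈⟨ ·ₚ-as-*ₚ c (p *ₚ q) ⟨
  c ·ₚ (p *ₚ q)             ∎
  where
  open ≋-Reasoning
  open PolySolver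

∣ₚ-cancel-·ₚ : ∀ {c x d w} → c ≢ 0ℚ → c ·ₚ x ≋ d *ₚ w → d ∣ₚ x
∣ₚ-cancel-·ₚ {c} {x} {d} {w} c≢0 e = recip c c≢0 ·ₚ w , (begin
  x                               ≈⟨ recip-·ₚ-cancel c c≢0 x ⟨
  recip c c≢0 ·ₚ (c ·ₚ x)         ≈⟨ ·ₚ-cong refl e ⟩
  recip c c≢0 ·ₚ (d *ₚ w)         ≈⟨ *ₚ-·ₚ-comm (recip c c≢0) d w ⟨
  d *ₚ (recip c c≢0 ·ₚ w)         ∎)
  where open ≋-Reasoning

¬∣ₚderiv : ∀ {d} → ¬ IsConst d → ¬ d ∣ₚ deriv d
¬∣ₚderiv {d} d≉const (w , d′≋dw) with ¬IsConst⇒Degree-suc {d} d≉const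
... | k , dd with degree-or-zero w
...   | inj₁ w≋[] = Degree⇒≉[] (Degree-deriv dd) (≋-trans d′≋dw (≋-trans (*ₚ-congʳ d w≋[]) (*ₚ-zeroʳ d)))
...   | inj₂ (j , dw) = ℕP.<-irrefl (Degree-unique (Degree-deriv dd) (Degree-≋ (≋-sym d′≋dw) (Degree-*ₚ dd dw)))
                                     (s≤s (ℕP.m≤m+n k j))

separable-if-gcd-constant : ∀ {F} (G : GCD F (deriv F)) → Degree (GCD.gcd G) 0 → Separable F
separable-if-gcd-constant {F} G dg@(mkDegree c≢0 _) = c⁻¹ ·ₚ u , c⁻¹ ·ₚ v , coeff≡ (begin
  (c⁻¹ ·ₚ u) *ₚ F +ₚ (c⁻¹ ·ₚ v) *ₚ deriv F     ≈⟨ +ₚ-cong (·ₚ-*ₚ-assoc c⁻¹ u F) (·ₚ-*ₚ-assoc c⁻¹ v (deriv F)) ⟩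
  c⁻¹ ·ₚ (u *ₚ F) +ₚ c⁻¹ ·ₚ (v *ₚ deriv F)     ≈⟨ ·ₚ-distribˡ-+ₚ c⁻¹ (u *ₚ F) (v *ₚ deriv F) ⟨
  c⁻¹ ·ₚ (u *ₚ F +ₚ v *ₚ deriv F)             ≈⟨ ·ₚ-cong refl (≋-trans (GCD.bezout G) (Degree-zero⇒≋constP dg)) ⟩
  c⁻¹ ·ₚ constP c                             ≈⟨ ∷-cong (recip-inverseˡ c c≢0) ≋-refl ⟩
  oneP                                        ∎)
  where
  open ≋-Reasoning
  u   = GCD.u G
  v   = GCD.v G
  c   = coeff (GCD.gcd G) 0
  c⁻¹ = recip c c≢0

-- The gcd d of h and h′ divides h, so by irreducibility it is either a unit or an associate of h;
-- in the latter case h would divide h′.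
irreducible⇒separable : ∀ h → Irreducible h → Separable h
irreducible⇒separable h (h≉const , irreducible) with gcdₚ h (deriv h)
... | G with degree-or-zero (GCD.gcd G)
...   | inj₁ d≋[]       = ⊥-elim (h≉const (≋[]⇒IsConst (≋-trans (proj₂ (GCD.gcd∣f G)) (≋[]⇒*ₚ≋[] _ _ d≋[]))))
...   | inj₂ (zero  , dg) = separable-if-gcd-constant G dg
...   | inj₂ (suc k , dg) with irreducible (GCD.gcd G) (proj₁ (GCD.gcd∣f G)) (coeff≡ (proj₂ (GCD.gcd∣f G)))
...     | inj₁ d-const = ⊥-elim (Degree-suc⇒¬IsConst dg d-const)
...     | inj₂ s-const = ⊥-elim (¬∣ₚderiv {h} h≉const (∣ₚ-cancel-·ₚ {c} {d = h} c≢0 c·h′≋ht))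
  where
  open ≋-Reasoning
  d    = GCD.gcd G
  s    = proj₁ (GCD.gcd∣f G)
  h≋ds = proj₂ (GCD.gcd∣f G)
  t    = proj₁ (GCD.gcd∣g G)
  c    = coeff s 0
  h≋c·d : h ≋ c ·ₚ d
  h≋c·d = ≋-trans h≋ds (≋-trans (*ₚ-congʳ d (IsConst⇒≋constP s-const)) (*ₚ-constP c d))
  c≢0 : c ≢ 0ℚ
  c≢0 c≡0 = h≉const (≋[]⇒IsConst (≋-trans h≋c·d (≋-trans (·ₚ-cong c≡0 ≋-refl) (·ₚ-zero d))))
  c·h′≋ht : c ·ₚ deriv h ≋ h *ₚ t
  c·h′≋ht = begin
    c ·ₚ deriv h          ≈⟨ ·ₚ-cong refl (proj₂ (GCD.gcd∣g G)) ⟩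
    c ·ₚ (d *ₚ t)         ≈⟨ ·ₚ-*ₚ-assoc c d t ⟨
    (c ·ₚ d) *ₚ t         ≈⟨ *ₚ-congˡ t h≋c·d ⟨
    h *ₚ t                ∎

rescale-square : ∀ {κ} (κ≢0 : κ ≢ 0ℚ) e S →
  e *ₚ (e *ₚ S) ≋ (κ ·ₚ e) *ₚ ((κ ·ₚ e) *ₚ (recip (κ ℚ.* κ) (*-≢0 κ≢0 κ≢0) ·ₚ S))
rescale-square {κ} κ≢0 e S = begin
  e *ₚ (e *ₚ S)                                   ≈⟨ *ₚ-identityˡ _ ⟨
  oneP *ₚ (e *ₚ (e *ₚ S))                         ≈⟨ *ₚ-congˡ (e *ₚ (e *ₚ S)) (∷-cong {p = []} κκr≡1 ≋-refl) ⟨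
  constP (κ ℚ.* (κ ℚ.* r)) *ₚ (e *ₚ (e *ₚ S))     ≈⟨ *ₚ-congˡ _ (≋-trans (constP-*ₚ κ _) (*ₚ-congʳ K (constP-*ₚ κ r))) ⟩
  (K *ₚ (K *ₚ R)) *ₚ (e *ₚ (e *ₚ S))              ≈⟨ solve 4 (λ K R e S → (K :* (K :* R)) :* (e :* (e :* S)) := (K :* e) :* ((K :* e) :* (R :* S)))
                                                             ≋-refl K R e S ⟩
  (K *ₚ e) *ₚ ((K *ₚ e) *ₚ (R *ₚ S))              ≈⟨ *ₚ-cong (≋-sym (·ₚ-as-*ₚ κ e)) (*ₚ-cong (≋-sym (·ₚ-as-*ₚ κ e)) (≋-sym (·ₚ-as-*ₚ r S))) ⟩
  (κ ·ₚ e) *ₚ ((κ ·ₚ e) *ₚ (r ·ₚ S))              ∎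
  where
  open ≋-Reasoning
  open PolySolver
  r = recip (κ ℚ.* κ) (*-≢0 κ≢0 κ≢0)
  K = constP κ
  R = constP r
  κκr≡1 : κ ℚ.* (κ ℚ.* r) ≡ 1ℚ
  κκr≡1 = trans (sym (ℚP.*-assoc κ κ r)) (recip-inverseʳ (κ ℚ.* κ) (*-≢0 κ≢0 κ≢0))

SquareFree : Poly → Set
SquareFree F = ∀ e S → ¬ IsConst e → ¬ F ≋ e *ₚ (e *ₚ S)

SquareFree-·ₚ⁻¹ : ∀ {c} F → c ≢ 0ℚ → SquareFree (c ·ₚ F) → SquareFree F
SquareFree-·ₚ⁻¹ {c} F c≢0 sf e S e≉const F≋eeS = sf e (c ·ₚ S) e≉const (begin
  c ·ₚ F                     ≈⟨ ·ₚ-cong refl F≋eeS ⟩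
  c ·ₚ (e *ₚ (e *ₚ S))       ≈⟨ *ₚ-·ₚ-comm c e (e *ₚ S) ⟨
  e *ₚ (c ·ₚ (e *ₚ S))       ≈⟨ *ₚ-congʳ e (*ₚ-·ₚ-comm c e S) ⟨
  e *ₚ (e *ₚ (c ·ₚ S))       ∎)
  where open ≋-Reasoning

∣ₚderiv-if-coprime-cofactor : ∀ {F d s α β c} → F ≋ d *ₚ s → d ∣ₚ deriv F →
  α *ₚ d +ₚ β *ₚ s ≋ constP c → c ≢ 0ℚ → d ∣ₚ deriv d
∣ₚderiv-if-coprime-cofactor {F} {d} {s} {α} {β} {c} F≋ds (t , F′≋dt) bezout c≢0 =
  ∣ₚ-cancel-·ₚ {c} {d = d} c≢0 (begin
    c ·ₚ deriv d                                   ≈⟨ *ₚ-constP c (deriv d) ⟨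
    deriv d *ₚ constP c                            ≈⟨ *ₚ-congʳ (deriv d) bezout ⟨
    deriv d *ₚ (α *ₚ d +ₚ β *ₚ s)                  ≈⟨ solve 5 (λ D′ A D B S → D′ :* (A :* D :+ B :* S) := D :* (A :* D′) :+ B :* (D′ :* S))
                                                            ≋-refl (deriv d) α d β s ⟩
    d *ₚ (α *ₚ deriv d) +ₚ β *ₚ (deriv d *ₚ s)     ≈⟨ +ₚ-cong ≋-refl (*ₚ-congʳ β d′s≋) ⟩
    d *ₚ (α *ₚ deriv d) +ₚ β *ₚ (d *ₚ (t -ₚ deriv s))
      ≈⟨ solve 5 (λ D A D′ B W → D :* (A :* D′) :+ B :* (D :* W) := D :* (A :* D′ :+ B :* W)) ≋-refl d α (deriv d) β (t -ₚ deriv s) ⟩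
    d *ₚ (α *ₚ deriv d +ₚ β *ₚ (t -ₚ deriv s))     ∎)
  where
  open ≋-Reasoning
  open PolySolver
  d′s≋ : deriv d *ₚ s ≋ d *ₚ (t -ₚ deriv s)
  d′s≋ = begin
    deriv d *ₚ s                                     ≈⟨ solve 3 (λ D′ S A → D′ :* S := (D′ :* S :+ A) :- A) ≋-refl (deriv d) s (d *ₚ deriv s) ⟩
    (deriv d *ₚ s +ₚ d *ₚ deriv s) -ₚ d *ₚ deriv s   ≈⟨ +ₚ-cong (≋-sym (≋-trans (deriv-cong F≋ds) (deriv-*ₚ d s))) ≋-refl ⟩
    deriv F -ₚ d *ₚ deriv s                          ≈⟨ +ₚ-cong F′≋dt ≋-refl ⟩
    d *ₚ t -ₚ d *ₚ deriv s                           ≈⟨ solve 3 (λ D T S′ → D :* T :- D :* S′ := D :* (T :- S′)) ≋-refl d t (deriv s) ⟩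
    d *ₚ (t -ₚ deriv s)                              ∎

-- With d = gcd (F, F′) and F = d s: if gcd (d, s) is a nonconstant e then e² ∣ F,
-- and otherwise d ∣ d′, so d is constant.
squareFree⇒separable : ∀ F → ¬ F ≋ [] → SquareFree F → Separable F
squareFree⇒separable F F≉[] squareFree with gcdₚ F (deriv F)
... | G with degree-or-zero (GCD.gcd G)
...   | inj₁ d≋[]         = ⊥-elim (F≉[] (≋-trans (proj₂ (GCD.gcd∣f G)) (≋[]⇒*ₚ≋[] _ _ d≋[])))
...   | inj₂ (zero  , dg) = separable-if-gcd-constant G dg
...   | inj₂ (suc k , dg) with gcdₚ (GCD.gcd G) (proj₁ (GCD.gcd∣f G))
...     | G₂ with degree-or-zero (GCD.gcd G₂)
...       | inj₁ e≋[]         = ⊥-elim (Degree⇒≉[] dg (≋-trans (proj₂ (GCD.gcd∣f G₂)) (≋[]⇒*ₚ≋[] _ _ e≋[])))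
...       | inj₂ (zero  , de) = ⊥-elim (¬∣ₚderiv {GCD.gcd G} (Degree-suc⇒¬IsConst dg)
                                  (∣ₚderiv-if-coprime-cofactor {α = GCD.u G₂} {GCD.v G₂} (proj₂ (GCD.gcd∣f G)) (GCD.gcd∣g G)
                                    (≋-trans (GCD.bezout G₂) (Degree-zero⇒≋constP de)) (Degree.lead≢0 de)))
...       | inj₂ (suc j , de) = ⊥-elim (squareFree e (d₁ *ₚ s₁) (Degree-suc⇒¬IsConst de) (begin
    F                              ≈⟨ proj₂ (GCD.gcd∣f G) ⟩
    GCD.gcd G *ₚ s                 ≈⟨ *ₚ-cong (proj₂ (GCD.gcd∣f G₂)) (proj₂ (GCD.gcd∣g G₂)) ⟩
    (e *ₚ d₁) *ₚ (e *ₚ s₁)         ≈⟨ solve 3 (λ E D S → (E :* D) :* (E :* S) := E :* (E :* (D :* S))) ≋-refl e d₁ s₁ ⟩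
    e *ₚ (e *ₚ (d₁ *ₚ s₁))         ∎))
  where
  open ≋-Reasoning
  open PolySolver
  s  = proj₁ (GCD.gcd∣f G)
  e  = GCD.gcd G₂
  d₁ = proj₁ (GCD.gcd∣f G₂)
  s₁ = proj₁ (GCD.gcd∣g G₂)

IsInteger : ℚ → Set
IsInteger x = Σ ℤ λ z → x ≡ ι z

ι-isInteger : ∀ z → IsInteger (ι z)
ι-isInteger z = z , refl

IsInteger-+ : ∀ {x y} → IsInteger x → IsInteger y → IsInteger (x ℚ.+ y)
IsInteger-+ (a , refl) (b , refl) = a ℤ.+ b , sym (ι-+ a b)

IsInteger-* : ∀ {x y} → IsInteger x → IsInteger y → IsInteger (x ℚ.* y)
IsInteger-* (a , refl) (b , refl) = a ℤ.* b , sym (ι-* a b)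

IsInteger-neg : ∀ {x} → IsInteger x → IsInteger (ℚ.- x)
IsInteger-neg (a , refl) = ℤ.- a , sym (ι-neg a)

IntegralPoly-≋ : ∀ {f g} → f ≋ g → IntegralPoly f → IntegralPoly g
IntegralPoly-≋ e i n = subst IsInteger (coeff≡ e n) (i n)

IntegralPoly-[] : IntegralPoly []
IntegralPoly-[] n = ι-isInteger (+ 0)

IntegralPoly-∷ : ∀ {a f} → IsInteger a → IntegralPoly f → IntegralPoly (a ∷ f)
IntegralPoly-∷ ia i zero    = ia
IntegralPoly-∷ ia i (suc n) = i n

IntegralPoly-+ₚ : ∀ f {g} → IntegralPoly f → IntegralPoly g → IntegralPoly (f +ₚ g)
IntegralPoly-+ₚ f {g} i j n = subst IsInteger (sym (coeff-+ₚ f g n)) (IsInteger-+ (i n) (j n))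

IntegralPoly-·ₚ : ∀ {c} f → IsInteger c → IntegralPoly f → IntegralPoly (c ·ₚ f)
IntegralPoly-·ₚ {c} f ic i n = subst IsInteger (sym (coeff-·ₚ c f n)) (IsInteger-* ic (i n))

IntegralPoly--ₚ : ∀ f {g} → IntegralPoly f → IntegralPoly g → IntegralPoly (f -ₚ g)
IntegralPoly--ₚ f {g} i j = IntegralPoly-+ₚ f i (IntegralPoly-·ₚ g (IsInteger-neg (ι-isInteger (+ 1))) j)

IntegralPoly-*ₚ : ∀ f {g} → IntegralPoly f → IntegralPoly g → IntegralPoly (f *ₚ g)
IntegralPoly-*ₚ []       i j = IntegralPoly-[]
IntegralPoly-*ₚ (a ∷ as) {g} i j =
  IntegralPoly-+ₚ (a ·ₚ g) (IntegralPoly-·ₚ g (i 0) j)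
                  (IntegralPoly-∷ (ι-isInteger (+ 0)) (IntegralPoly-*ₚ as (λ n → i (suc n)) j))

IntegralPoly-deriv : ∀ f → IntegralPoly f → IntegralPoly (deriv f)
IntegralPoly-deriv f i n = subst IsInteger (sym (coeff-deriv f n)) (IsInteger-* (ι-isInteger (+ suc n)) (i (suc n)))

IntegralPoly-constP : ∀ z → IntegralPoly (constP (ι z))
IntegralPoly-constP z = IntegralPoly-∷ (ι-isInteger z) IntegralPoly-[]

IntegralPoly-XP : IntegralPoly XP
IntegralPoly-XP = IntegralPoly-∷ (ι-isInteger (+ 0)) (IntegralPoly-constP (+ 1))

IntegralPoly-^ₚ : ∀ f n → IntegralPoly f → IntegralPoly (f ^ₚ n)
IntegralPoly-^ₚ f zero    i = IntegralPoly-constP (+ 1)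
IntegralPoly-^ₚ f (suc n) i = IntegralPoly-*ₚ f i (IntegralPoly-^ₚ f n i)

↧ₙ*-isInteger : ∀ a → IsInteger (ι (+ ℚ.↧ₙ a) ℚ.* a)
↧ₙ*-isInteger a@(mkℚ n d _) = n , ℚP.toℚᵘ-injective (begin
  ℚ.toℚᵘ (ι (+ suc d) ℚ.* a)                    ≈⟨ ℚP.toℚᵘ-homo-* (ι (+ suc d)) a ⟩
  ℚ.toℚᵘ (ι (+ suc d)) ℚᵘ.* ℚᵘ.mkℚᵘ n d          ≈⟨ ℚᵘP.*-congʳ (ι-toℚᵘ (+ suc d)) ⟩
  ℚᵘ.mkℚᵘ (+ suc d) 0 ℚᵘ.* ℚᵘ.mkℚᵘ n d           ≈⟨ ℚᵘ.*≡* (ℤ-solve d n) ⟩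
  ℚᵘ.mkℚᵘ n 0                                    ≈⟨ ι-toℚᵘ n ⟨
  ℚ.toℚᵘ (ι n)                                   ∎)
  where
  open ℚᵘP.≃-Reasoning
  ℤ-solve : ∀ d n → (+ suc d ℤ.* n) ℤ.* + 1 ≡ n ℤ.* + (1 ℕ.* suc d)
  ℤ-solve d n = trans (ℤP.*-identityʳ (+ suc d ℤ.* n)) (trans (ℤP.*-comm (+ suc d) n) (cong (λ x → n ℤ.* + x) (sym (ℕP.*-identityˡ (suc d)))))

clearDenominators : ∀ f → Σ ℕ λ δ → δ ≢ 0 × IntegralPoly (ι (+ δ) ·ₚ f)
clearDenominators []       = 1 , (λ ()) , IntegralPoly-[]
clearDenominators (a ∷ as) with clearDenominators as
... | δ , δ≢0 , integral = ℚ.↧ₙ a * δ , ↧δ≢0 , IntegralPoly-∷ head tail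
  where
  ι↧δ = ι-pos-* (ℚ.↧ₙ a) δ
  ↧δ≢0 : ℚ.↧ₙ a * δ ≢ 0
  ↧δ≢0 e with ℕP.m*n≡0⇒m≡0∨n≡0 (ℚ.↧ₙ a) e
  ... | inj₁ ()
  ... | inj₂ δ≡0 = δ≢0 δ≡0
  head : IsInteger (ι (+ (ℚ.↧ₙ a * δ)) ℚ.* a)
  head = subst IsInteger
    (trans (sym (ℚP.*-assoc (ι (+ δ)) (ι (+ ℚ.↧ₙ a)) a)) (cong (ℚ._* a) (trans (ℚP.*-comm (ι (+ δ)) _) (sym ι↧δ))))
    (IsInteger-* (ι-isInteger (+ δ)) (↧ₙ*-isInteger a))
  tail : IntegralPoly (ι (+ (ℚ.↧ₙ a * δ)) ·ₚ as)
  tail = IntegralPoly-≋ (≋-trans (·ₚ-assoc (ι (+ ℚ.↧ₙ a)) (ι (+ δ)) as) (·ₚ-cong (sym ι↧δ) ≋-refl))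
                        (IntegralPoly-·ₚ (ι (+ δ) ·ₚ as) (ι-isInteger (+ ℚ.↧ₙ a)) integral)

-- Differentiating c G = E (E T) exhibits E as a factor of c (u G + v G′); comparing with
-- u H + v H′ = D, the difference is c (u (G - H) + v (G′ - H′)).
square-factor-bezout : ∀ {G H E T u v} c D → u *ₚ H +ₚ v *ₚ deriv H ≋ constP D → c ·ₚ G ≋ E *ₚ (E *ₚ T) →
  E *ₚ (u *ₚ (E *ₚ T) +ₚ v *ₚ (deriv E *ₚ T +ₚ deriv (E *ₚ T))) -ₚ constP (c ℚ.* D)
    ≋ c ·ₚ (u *ₚ (G -ₚ H) +ₚ v *ₚ (deriv G -ₚ deriv H))
square-factor-bezout {G} {H} {E} {T} {u} {v} c D bezout cG≋EET = begin
  E *ₚ (u *ₚ Y +ₚ v *ₚ Z) -ₚ constP (c ℚ.* D)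
    ≈⟨ +ₚ-cong ≋-refl (negP-cong (≋-trans (constP-*ₚ c D) (*ₚ-congʳ C (≋-sym bezout)))) ⟩
  E *ₚ (u *ₚ Y +ₚ v *ₚ Z) -ₚ C *ₚ (u *ₚ H +ₚ v *ₚ deriv H)
    ≈⟨ solve 7 (λ E U Y V Z C K → E :* (U :* Y :+ V :* Z) :- C :* K := U :* (E :* Y) :+ V :* (E :* Z) :- C :* K)
               ≋-refl E u Y v Z C (u *ₚ H +ₚ v *ₚ deriv H) ⟩
  u *ₚ (E *ₚ Y) +ₚ v *ₚ (E *ₚ Z) -ₚ C *ₚ (u *ₚ H +ₚ v *ₚ deriv H)
    ≈⟨ +ₚ-cong (+ₚ-cong (*ₚ-congʳ u EY≋CG) (*ₚ-congʳ v EZ≋CG′)) ≋-refl ⟩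
  u *ₚ (C *ₚ G) +ₚ v *ₚ (C *ₚ deriv G) -ₚ C *ₚ (u *ₚ H +ₚ v *ₚ deriv H)
    ≈⟨ solve 7 (λ U V C G G′ H H′ → U :* (C :* G) :+ V :* (C :* G′) :- C :* (U :* H :+ V :* H′)
                                  := C :* (U :* (G :- H) :+ V :* (G′ :- H′)))
               ≋-refl u v C G (deriv G) H (deriv H) ⟩
  C *ₚ (u *ₚ (G -ₚ H) +ₚ v *ₚ (deriv G -ₚ deriv H))
    ≈⟨ ·ₚ-as-*ₚ c _ ⟨
  c ·ₚ (u *ₚ (G -ₚ H) +ₚ v *ₚ (deriv G -ₚ deriv H))
    ∎
  where
  open ≋-Reasoning
  open PolySolver
  C = constP c
  Y = E *ₚ T
  Z = deriv E *ₚ T +ₚ deriv Y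
  EY≋CG : E *ₚ Y ≋ C *ₚ G
  EY≋CG = ≋-trans (≋-sym cG≋EET) (·ₚ-as-*ₚ c G)
  EZ≋CG′ : E *ₚ Z ≋ C *ₚ deriv G
  EZ≋CG′ = begin
    E *ₚ Z                               ≈⟨ solve 4 (λ E E′ T Y′ → E :* (E′ :* T :+ Y′) := E′ :* (E :* T) :+ E :* Y′) ≋-refl E (deriv E) T (deriv Y) ⟩
    deriv E *ₚ Y +ₚ E *ₚ deriv Y         ≈⟨ deriv-*ₚ E Y ⟨
    deriv (E *ₚ Y)                       ≈⟨ deriv-cong (≋-sym cG≋EET) ⟩
    deriv (c ·ₚ G)                       ≈⟨ deriv-·ₚ c G ⟩
    c ·ₚ deriv G                         ≈⟨ ·ₚ-as-*ₚ c (deriv G) ⟩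
    C *ₚ deriv G                         ∎

record Monic (f : Poly) (d : ℕ) : Set where
  constructor mkMonic
  field
    below  : DegreeBelow f (suc d)
    lead≡1 : coeff f d ≡ 1ℚ

Monic⇒Degree : ∀ {f d} → Monic f d → Degree f d
Monic⇒Degree (mkMonic below lead≡1) = mkDegree (λ e → ℚP.1≢0 (trans (sym lead≡1) e)) below

Monic-*ₚ : ∀ {f g i j} → Monic f i → Monic g j → Monic (f *ₚ g) (i + j)
Monic-*ₚ {f} {g} {i} {j} (mkMonic below lead≡1) (mkMonic below′ lead′≡1) =
  mkMonic (proj₁ lt) (trans (proj₂ lt) (trans (cong₂ ℚ._*_ lead≡1 lead′≡1) (ℚP.*-identityˡ 1ℚ)))
  where lt = leading-*ₚ f g i j below below′

Monic-oneP : Monic oneP 0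
Monic-oneP = mkMonic (λ { (suc k) _ → refl }) refl

Monic-^ₚ : ∀ {f d} n → Monic f d → Monic (f ^ₚ n) (n * d)
Monic-^ₚ zero    _  = Monic-oneP
Monic-^ₚ (suc n) mf = Monic-*ₚ mf (Monic-^ₚ n mf)

Monic-X-c : ∀ c → Monic (XP -ₚ constP c) 1
Monic-X-c c = mkMonic (λ { (suc zero) (s≤s ()) ; (suc (suc k)) _ → refl }) refl

Monic-prodLin : ∀ r a → Monic (prodLin r a) r
Monic-prodLin zero    a = Monic-oneP
Monic-prodLin (suc r) a = Monic-*ₚ (Monic-X-c (ι (a Fin.zero))) (Monic-prodLin r (λ k → a (Fin.suc k)))

IntegralPoly-prodLin : ∀ r a → IntegralPoly (prodLin r a)
IntegralPoly-prodLin zero    a = IntegralPoly-constP (+ 1)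
IntegralPoly-prodLin (suc r) a =
  IntegralPoly-*ₚ (XP -ₚ constP (ι (a Fin.zero)))
    {prodLin r (λ k → a (Fin.suc k))}
    (IntegralPoly--ₚ XP {constP (ι (a Fin.zero))} IntegralPoly-XP (IntegralPoly-constP (a Fin.zero)))
    (IntegralPoly-prodLin r (λ k → a (Fin.suc k)))

coeff--ₚoneP : ∀ h k → coeff (h -ₚ oneP) (suc k) ≡ coeff h (suc k)
coeff--ₚoneP h k = trans (coeff--ₚ h oneP (suc k)) (ℚP.+-identityʳ (coeff h (suc k)))

perturbation-expansion : ∀ h c L → (h -ₚ oneP) *ₚ (c ·ₚ L +ₚ oneP) +ₚ oneP ≋ h +ₚ c ·ₚ (L *ₚ (h -ₚ oneP))
perturbation-expansion h c L = begin
  (h -ₚ oneP) *ₚ (c ·ₚ L +ₚ oneP) +ₚ oneP            ≈⟨ +ₚ-cong (*ₚ-congʳ (h -ₚ oneP) (+ₚ-cong (·ₚ-as-*ₚ c L) ≋-refl)) ≋-refl ⟩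
  (h -ₚ oneP) *ₚ (constP c *ₚ L +ₚ oneP) +ₚ oneP     ≈⟨ solve 3 (λ H C L → (H :- con 1ℚ) :* (C :* L :+ con 1ℚ) :+ con 1ℚ
                                                                     := H :+ C :* (L :* (H :- con 1ℚ))) ≋-refl h (constP c) L ⟩
  h +ₚ constP c *ₚ (L *ₚ (h -ₚ oneP))                ≈⟨ +ₚ-cong ≋-refl (·ₚ-as-*ₚ c (L *ₚ (h -ₚ oneP))) ⟨
  h +ₚ c ·ₚ (L *ₚ (h -ₚ oneP))                       ∎
  where
  open ≋-Reasoning
  open PolySolver

scaled-perturbation-difference : ∀ m a b L h →
  m ·ₚ (h +ₚ (a ℚ.* b) ·ₚ (L *ₚ (h -ₚ oneP))) -ₚ m ·ₚ h ≋ a ·ₚ (b ·ₚ (L *ₚ (m ·ₚ h -ₚ constP m)))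
scaled-perturbation-difference m a b L h = begin
  m ·ₚ (h +ₚ (a ℚ.* b) ·ₚ (L *ₚ (h -ₚ oneP))) -ₚ m ·ₚ h
    ≈⟨ +ₚ-cong (≋-trans (·ₚ-as-*ₚ m _) (*ₚ-congʳ M (+ₚ-cong (≋-refl {h}) (≋-trans (·ₚ-as-*ₚ (a ℚ.* b) P) (*ₚ-congˡ P (constP-*ₚ a b))))))
               (negP-cong (·ₚ-as-*ₚ m h)) ⟩
  M *ₚ (h +ₚ (A *ₚ B) *ₚ (L *ₚ (h -ₚ oneP))) -ₚ M *ₚ h
    ≈⟨ solve 5 (λ M A B L H → M :* (H :+ (A :* B) :* (L :* (H :- con 1ℚ))) :- M :* H := A :* (B :* (L :* (M :* H :- M))))
               ≋-refl M A B L h ⟩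
  A *ₚ (B *ₚ (L *ₚ (M *ₚ h -ₚ M)))
    ≈⟨ ≋-trans (·ₚ-as-*ₚ a _) (*ₚ-congʳ A (≋-trans (·ₚ-as-*ₚ b _) (*ₚ-congʳ B (*ₚ-congʳ L (+ₚ-cong (·ₚ-as-*ₚ m h) ≋-refl))))) ⟨
  a ·ₚ (b ·ₚ (L *ₚ (m ·ₚ h -ₚ constP m)))
    ∎
  where
  open ≋-Reasoning
  open PolySolver
  M = constP m
  A = constP a
  B = constP b
  P = L *ₚ (h -ₚ oneP)

perturbation-degree : ∀ {h L c d e} → Degree h d → 1 ≤ d → Monic L e → 1 ≤ e → c ≢ 0ℚ →
  Degree (h +ₚ c ·ₚ (L *ₚ (h -ₚ oneP))) (e + d) × coeff (h +ₚ c ·ₚ (L *ₚ (h -ₚ oneP))) (e + d) ≡ c ℚ.* coeff h d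
perturbation-degree {h} {L} {c} {suc d} {e} (mkDegree lead≢0 above) (s≤s z≤n) mL 1≤e c≢0 =
  proj₁ sum , trans (proj₂ sum) lead
  where
  open ≡-Reasoning
  dh-1 : Degree (h -ₚ oneP) (suc d)
  dh-1 = mkDegree (λ e → lead≢0 (trans (sym (coeff--ₚoneP h d)) e))
                  (λ { (suc k) d<k → trans (coeff--ₚoneP h k) (above (suc k) d<k) })
  h-below : DegreeBelow h (e + suc d)
  h-below = DegreeBelow-mono {h} (ℕP.+-monoˡ-≤ (suc d) 1≤e) above
  sum = Degree-+ₚ-lower {g = h} h-below (Degree-·ₚ c≢0 (Degree-*ₚ (Monic⇒Degree mL) dh-1))
  lead : coeff (c ·ₚ (L *ₚ (h -ₚ oneP))) (e + suc d) ≡ c ℚ.* coeff h (suc d)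
  lead = begin
    coeff (c ·ₚ (L *ₚ (h -ₚ oneP))) (e + suc d)            ≡⟨ coeff-·ₚ c (L *ₚ (h -ₚ oneP)) (e + suc d) ⟩
    c ℚ.* coeff (L *ₚ (h -ₚ oneP)) (e + suc d)             ≡⟨ cong (c ℚ.*_) (coeff-*ₚ-leading (Monic⇒Degree mL) dh-1) ⟩
    c ℚ.* (coeff L e ℚ.* coeff (h -ₚ oneP) (suc d))        ≡⟨ cong (λ x → c ℚ.* (x ℚ.* coeff (h -ₚ oneP) (suc d))) (Monic.lead≡1 mL) ⟩
    c ℚ.* (1ℚ ℚ.* coeff (h -ₚ oneP) (suc d))               ≡⟨ cong (c ℚ.*_) (trans (ℚP.*-identityˡ _) (coeff--ₚoneP h d)) ⟩
    c ℚ.* coeff h (suc d)                                  ∎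

bezout-·ₚ : ∀ {h U V} δ m → U *ₚ h +ₚ V *ₚ deriv h ≋ oneP →
  (δ ·ₚ U) *ₚ (m ·ₚ h) +ₚ (δ ·ₚ V) *ₚ deriv (m ·ₚ h) ≋ constP (δ ℚ.* m)
bezout-·ₚ {h} {U} {V} δ m bezout = begin
  (δ ·ₚ U) *ₚ (m ·ₚ h) +ₚ (δ ·ₚ V) *ₚ deriv (m ·ₚ h)
    ≈⟨ +ₚ-cong ≋-refl (*ₚ-congʳ (δ ·ₚ V) (deriv-·ₚ m h)) ⟩
  (δ ·ₚ U) *ₚ (m ·ₚ h) +ₚ (δ ·ₚ V) *ₚ (m ·ₚ deriv h)
    ≈⟨ +ₚ-cong (*ₚ-cong (·ₚ-as-*ₚ δ U) (·ₚ-as-*ₚ m h)) (*ₚ-cong (·ₚ-as-*ₚ δ V) (·ₚ-as-*ₚ m (deriv h))) ⟩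
  (Δ *ₚ U) *ₚ (M *ₚ h) +ₚ (Δ *ₚ V) *ₚ (M *ₚ deriv h)
    ≈⟨ solve 6 (λ Δ M U V H H′ → (Δ :* U) :* (M :* H) :+ (Δ :* V) :* (M :* H′) := (Δ :* M) :* (U :* H :+ V :* H′))
               ≋-refl Δ M U V h (deriv h) ⟩
  (Δ *ₚ M) *ₚ (U *ₚ h +ₚ V *ₚ deriv h)
    ≈⟨ *ₚ-cong (≋-sym (constP-*ₚ δ m)) bezout ⟩
  constP (δ ℚ.* m) *ₚ oneP
    ≈⟨ *ₚ-identityʳ _ ⟩
  constP (δ ℚ.* m)
    ∎
  where
  open ≋-Reasoning
  open PolySolver
  Δ = constP δ
  M = constP m

record IntegralBezout (H : Poly) : Set where
  field
    u v        : Poly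
    D          : ℤ
    D≢0        : D ≢ + 0
    u-integral : IntegralPoly u
    v-integral : IntegralPoly v
    bezout     : u *ₚ H +ₚ v *ₚ deriv H ≋ constP (ι D)

integralBezout : ∀ h m → Separable h → m ≢ + 0 → IntegralBezout (ι m ·ₚ h)
integralBezout h m (U , V , bez) m≢0 = record
  { u = ι (+ δ) ·ₚ U ; v = ι (+ δ) ·ₚ V ; D = + δ ℤ.* m
  ; D≢0 = λ e → [ (λ δ≡0 → δ≢0 (ℤP.+-injective δ≡0)) , m≢0 ]′ (ℤP.i*j≡0⇒i≡0∨j≡0 (+ δ) e)
  ; u-integral = IntegralPoly-≋ (≋-trans (·ₚ-assoc (ι (+ δV)) (ι (+ δU)) U) (·ₚ-cong ιδ≡δVδU ≋-refl))
                   (IntegralPoly-·ₚ (ι (+ δU) ·ₚ U) (ι-isInteger (+ δV)) δU·U-integral)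
  ; v-integral = IntegralPoly-≋ (≋-trans (·ₚ-assoc (ι (+ δU)) (ι (+ δV)) V) (·ₚ-cong (sym (ι-pos-* δU δV)) ≋-refl))
                   (IntegralPoly-·ₚ (ι (+ δV) ·ₚ V) (ι-isInteger (+ δU)) δV·V-integral)
  ; bezout = ≋-trans (bezout-·ₚ {h} {U} {V} (ι (+ δ)) (ι m) (mk≋ bez))
                     (∷-cong (sym (ι-* (+ δ) m)) ≋-refl) }
  where
  δU = proj₁ (clearDenominators U)
  δV = proj₁ (clearDenominators V)
  δU·U-integral = proj₂ (proj₂ (clearDenominators U))
  δV·V-integral = proj₂ (proj₂ (clearDenominators V))
  δ = δU * δV
  ιδ≡δVδU : ι (+ δV) ℚ.* ι (+ δU) ≡ ι (+ δ)
  ιδ≡δVδU = trans (ℚP.*-comm (ι (+ δV)) (ι (+ δU))) (sym (ι-pos-* δU δV))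
  δ≢0 : δ ≢ 0
  δ≢0 e = [ proj₁ (proj₂ (clearDenominators U)) , proj₁ (proj₂ (clearDenominators V)) ]′ (ℕP.m*n≡0⇒m≡0∨n≡0 δU e)

module ModPrime (p : ℕ) (p-prime : Prime p) where

  pℤ : ℤ
  pℤ = + p

  p>1 : 1 < p
  p>1 = ℕ.nonTrivial⇒n>1 p {{prime⇒nonTrivial p-prime}}

  p≢0 : p ≢ 0
  p≢0 = ℕ.≢-nonZero⁻¹ p {{prime⇒nonZero p-prime}}

  ιp≢0 : ι pℤ ≢ 0ℚ
  ιp≢0 = ι-pos≢0 {p} p≢0

  MultipleOfP : ℚ → Set
  MultipleOfP x = Σ ℤ λ z → x ≡ ι (z ℤ.* pℤ)

  multipleOfP-0 : MultipleOfP 0ℚ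
  multipleOfP-0 = + 0 , refl

  multipleOfP⇒isInteger : ∀ {x} → MultipleOfP x → IsInteger x
  multipleOfP⇒isInteger (z , e) = z ℤ.* pℤ , e

  multipleOfP-+ : ∀ {x y} → MultipleOfP x → MultipleOfP y → MultipleOfP (x ℚ.+ y)
  multipleOfP-+ (a , refl) (b , refl) =
    a ℤ.+ b , trans (sym (ι-+ (a ℤ.* pℤ) (b ℤ.* pℤ))) (cong ι (sym (ℤP.*-distribʳ-+ pℤ a b)))

  multipleOfP-*ʳ : ∀ {x y} → MultipleOfP x → IsInteger y → MultipleOfP (x ℚ.* y)
  multipleOfP-*ʳ (a , refl) (b , refl) =
    a ℤ.* b , trans (sym (ι-* (a ℤ.* pℤ) b)) (cong ι (solve 3 (λ A B P → (A :* P) :* B := (A :* B) :* P) refl a b pℤ))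
    where open ℤ-Solver

  multipleOfP-*ˡ : ∀ {x y} → IsInteger x → MultipleOfP y → MultipleOfP (x ℚ.* y)
  multipleOfP-*ˡ {x} {y} ix my = subst MultipleOfP (ℚP.*-comm y x) (multipleOfP-*ʳ my ix)

  multipleOfP-neg : ∀ {x} → MultipleOfP x → MultipleOfP (ℚ.- x)
  multipleOfP-neg (a , refl) = ℤ.- a , trans (sym (ι-neg (a ℤ.* pℤ))) (cong ι (ℤP.neg-distribˡ-* a pℤ))

  multipleOfP-cancelˡ : ∀ {x y} → MultipleOfP x → MultipleOfP (x ℚ.+ y) → MultipleOfP y
  multipleOfP-cancelˡ {x} {y} mx mxy = subst MultipleOfP (solve 2 (λ X Y → (X :+ Y) :+ (:- X) := Y) refl x y)
                                          (multipleOfP-+ mxy (multipleOfP-neg mx))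
    where open ℚ-Solver

  multipleOfP-cancelʳ : ∀ {x y} → MultipleOfP y → MultipleOfP (x ℚ.+ y) → MultipleOfP x
  multipleOfP-cancelʳ {x} {y} my mxy = multipleOfP-cancelˡ my (subst MultipleOfP (ℚP.+-comm x y) mxy)

  multipleOfP⇒∣ : ∀ z → MultipleOfP (ι z) → p ∣ ℤ.∣ z ∣
  multipleOfP⇒∣ z (w , e) = ℤS.∣⇒∣ᵤ {pℤ} {z} (ℤS.divides w (ι-injective e))

  ∣⇒multipleOfP : ∀ z → p ∣ ℤ.∣ z ∣ → MultipleOfP (ι z)
  ∣⇒multipleOfP z p∣z with ℤS.∣ᵤ⇒∣ {pℤ} {z} p∣z
  ... | ℤS.divides q z≡qp = q , cong ι z≡qp

  multipleOfP? : ∀ {x} → IsInteger x → Dec (MultipleOfP x)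
  multipleOfP? (z , refl) = map′ (∣⇒multipleOfP z) (multipleOfP⇒∣ z) (p ∣? ℤ.∣ z ∣)

  ¬multipleOfP-* : ∀ {x y} → IsInteger x → IsInteger y → ¬ MultipleOfP x → ¬ MultipleOfP y → ¬ MultipleOfP (x ℚ.* y)
  ¬multipleOfP-* (a , refl) (b , refl) ¬mx ¬my mxy
    with euclidsLemma ℤ.∣ a ∣ ℤ.∣ b ∣ p-prime (subst (p ∣_) (ℤP.abs-* a b) (multipleOfP⇒∣ (a ℤ.* b) (subst MultipleOfP (sym (ι-* a b)) mxy)))
  ... | inj₁ p∣a = ¬mx (∣⇒multipleOfP a p∣a)
  ... | inj₂ p∣b = ¬my (∣⇒multipleOfP b p∣b)

  ZeroModP : Poly → Set
  ZeroModP f = ∀ n → MultipleOfP (coeff f n)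

  ZeroModP-≋ : ∀ {f g} → f ≋ g → ZeroModP f → ZeroModP g
  ZeroModP-≋ e z n = subst MultipleOfP (coeff≡ e n) (z n)

  ZeroModP⇒IntegralPoly : ∀ {f} → ZeroModP f → IntegralPoly f
  ZeroModP⇒IntegralPoly z n = multipleOfP⇒isInteger (z n)

  ZeroModP-∷ : ∀ {a f} → MultipleOfP a → ZeroModP f → ZeroModP (a ∷ f)
  ZeroModP-∷ ma z zero    = ma
  ZeroModP-∷ ma z (suc n) = z n

  ZeroModP-+ₚ : ∀ f {g} → ZeroModP f → ZeroModP g → ZeroModP (f +ₚ g)
  ZeroModP-+ₚ f {g} zf zg n = subst MultipleOfP (sym (coeff-+ₚ f g n)) (multipleOfP-+ (zf n) (zg n))

  ZeroModP-·ₚ : ∀ {c} f → IsInteger c → ZeroModP f → ZeroModP (c ·ₚ f)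
  ZeroModP-·ₚ {c} f ic z n = subst MultipleOfP (sym (coeff-·ₚ c f n)) (multipleOfP-*ˡ ic (z n))

  multipleOfP-·ₚ : ∀ {c} f → MultipleOfP c → IntegralPoly f → ZeroModP (c ·ₚ f)
  multipleOfP-·ₚ {c} f mc i n = subst MultipleOfP (sym (coeff-·ₚ c f n)) (multipleOfP-*ʳ mc (i n))

  ZeroModP--ₚ : ∀ f {g} → ZeroModP f → ZeroModP g → ZeroModP (f -ₚ g)
  ZeroModP--ₚ f {g} zf zg = ZeroModP-+ₚ f zf (ZeroModP-·ₚ g (IsInteger-neg (ι-isInteger (+ 1))) zg)

  ZeroModP-*ₚˡ : ∀ f {g} → ZeroModP f → IntegralPoly g → ZeroModP (f *ₚ g)
  ZeroModP-*ₚˡ []       z i = λ _ → multipleOfP-0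
  ZeroModP-*ₚˡ (a ∷ as) {g} z i =
    ZeroModP-+ₚ (a ·ₚ g) (multipleOfP-·ₚ g (z 0) i) (ZeroModP-∷ multipleOfP-0 (ZeroModP-*ₚˡ as (λ n → z (suc n)) i))

  ZeroModP-*ₚʳ : ∀ f {g} → IntegralPoly f → ZeroModP g → ZeroModP (f *ₚ g)
  ZeroModP-*ₚʳ f {g} i z = ZeroModP-≋ (*ₚ-comm g f) (ZeroModP-*ₚˡ g z i)

  ZeroModP-deriv : ∀ f → ZeroModP f → ZeroModP (deriv f)
  ZeroModP-deriv f z n = subst MultipleOfP (sym (coeff-deriv f n)) (multipleOfP-*ˡ (ι-isInteger (+ suc n)) (z (suc n)))

  p·ₚ-zeroModP : ∀ f → IntegralPoly f → ZeroModP (ι pℤ ·ₚ f)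
  p·ₚ-zeroModP f = multipleOfP-·ₚ f (+ 1 , cong ι (sym (ℤP.*-identityˡ pℤ)))

  p⁻¹ : ℚ
  p⁻¹ = recip (ι pℤ) ιp≢0

  p⁻¹-cancel : ∀ w → p⁻¹ ℚ.* ι (w ℤ.* pℤ) ≡ ι w
  p⁻¹-cancel w = begin
    p⁻¹ ℚ.* ι (w ℤ.* pℤ)         ≡⟨ cong (p⁻¹ ℚ.*_) (trans (ι-* w pℤ) (ℚP.*-comm (ι w) (ι pℤ))) ⟩
    p⁻¹ ℚ.* (ι pℤ ℚ.* ι w)       ≡⟨ ℚP.*-assoc p⁻¹ (ι pℤ) (ι w) ⟨
    (p⁻¹ ℚ.* ι pℤ) ℚ.* ι w       ≡⟨ cong (ℚ._* ι w) (recip-inverseˡ (ι pℤ) ιp≢0) ⟩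
    1ℚ ℚ.* ι w                   ≡⟨ ℚP.*-identityˡ (ι w) ⟩
    ι w                          ∎
    where open ≡-Reasoning

  p⁻¹·ₚ-integral : ∀ f → ZeroModP f → IntegralPoly (p⁻¹ ·ₚ f)
  p⁻¹·ₚ-integral f z n with z n
  ... | w , e = w , trans (coeff-·ₚ p⁻¹ f n) (trans (cong (p⁻¹ ℚ.*_) e) (p⁻¹-cancel w))

  ∣w∣<∣w*p∣ : ∀ w → w ≢ + 0 → ℤ.∣ w ∣ < ℤ.∣ w ℤ.* pℤ ∣
  ∣w∣<∣w*p∣ w w≢0 = subst (ℤ.∣ w ∣ <_) (sym (ℤP.abs-* w pℤ))
    (ℕP.m<m*n ℤ.∣ w ∣ p {{ℕ.≢-nonZero (λ e → w≢0 (ℤP.∣i∣≡0⇒i≡0 e))}} p>1)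

  record DegreeModP (f : Poly) (i : ℕ) : Set where
    constructor mkDegreeModP
    field
      lead≢0 : ¬ MultipleOfP (coeff f i)
      above  : ∀ k → i < k → MultipleOfP (coeff f k)

  DegreeModP-≋ : ∀ {f g i} → f ≋ g → DegreeModP f i → DegreeModP g i
  DegreeModP-≋ e (mkDegreeModP lead≢0 above) =
    mkDegreeModP (λ m → lead≢0 (subst MultipleOfP (sym (coeff≡ e _)) m)) (λ k i<k → subst MultipleOfP (coeff≡ e k) (above k i<k))

  DegreeModP⇒¬ZeroModP : ∀ {f i} → DegreeModP f i → ¬ ZeroModP f
  DegreeModP⇒¬ZeroModP (mkDegreeModP lead≢0 _) z = lead≢0 (z _)

  zeroModP-or-degreeModP : ∀ f → IntegralPoly f → ZeroModP f ⊎ Σ ℕ (DegreeModP f)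
  zeroModP-or-degreeModP []       i = inj₁ (λ _ → multipleOfP-0)
  zeroModP-or-degreeModP (a ∷ as) i with zeroModP-or-degreeModP as (λ n → i (suc n))
  ... | inj₂ (j , mkDegreeModP lead≢0 above) =
          inj₂ (suc j , mkDegreeModP lead≢0 λ { (suc k) (s≤s j<k) → above k j<k })
  ... | inj₁ z with multipleOfP? (i 0)
  ...   | yes ma = inj₁ (ZeroModP-∷ ma z)
  ...   | no ¬ma = inj₂ (0 , mkDegreeModP ¬ma λ { (suc k) _ → z k })

  -- Gauss's lemma: reduction modulo p has no zero divisors.
  DegreeModP-*ₚ : ∀ f g {i j} → IntegralPoly f → IntegralPoly g →
                  DegreeModP f i → DegreeModP g j → DegreeModP (f *ₚ g) (i + j)
  DegreeModP-*ₚ []       g if ig (mkDegreeModP lead≢0 _) _ = ⊥-elim (lead≢0 multipleOfP-0)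
  DegreeModP-*ₚ (a ∷ as) g {zero} {j} if ig (mkDegreeModP a≢0 above) (mkDegreeModP lead≢0 aboveg) =
    mkDegreeModP (λ m → ¬multipleOfP-* (if 0) (ig j) a≢0 lead≢0 (multipleOfP-cancelʳ (rest j) (subst MultipleOfP (split j) m)))
                 (λ k j<k → subst MultipleOfP (sym (split k)) (multipleOfP-+ (multipleOfP-*ˡ (if 0) (aboveg k j<k)) (rest k)))
    where
    rest : ZeroModP (0ℚ ∷ (as *ₚ g))
    rest = ZeroModP-∷ multipleOfP-0 (ZeroModP-*ₚˡ as (λ k → above (suc k) (s≤s z≤n)) ig)
    split : ∀ k → coeff ((a ∷ as) *ₚ g) k ≡ a ℚ.* coeff g k ℚ.+ coeff (0ℚ ∷ (as *ₚ g)) k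
    split k = trans (coeff-+ₚ (a ·ₚ g) _ k) (cong (ℚ._+ _) (coeff-·ₚ a g k))
  DegreeModP-*ₚ (a ∷ as) g {suc i} {j} if ig (mkDegreeModP lead≢0 above) dg@(mkDegreeModP _ aboveg) =
    mkDegreeModP (λ m → DegreeModP.lead≢0 ih (multipleOfP-cancelˡ (a·g-above (suc (i + j)) (s≤s (ℕP.m≤n+m j i))) (subst MultipleOfP (split (i + j)) m)))
                 (λ { (suc k) (s≤s i+j<k) → subst MultipleOfP (sym (split k))
                        (multipleOfP-+ (a·g-above (suc k) (ℕP.≤-trans (s≤s (ℕP.m≤n+m j i)) (ℕP.<⇒≤ (s≤s i+j<k)))) (DegreeModP.above ih k i+j<k)) })
    where
    ih = DegreeModP-*ₚ as g (λ k → if (suc k)) ig (mkDegreeModP lead≢0 (λ k i<k → above (suc k) (s≤s i<k))) dg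
    a·g-above : ∀ k → j < k → MultipleOfP (a ℚ.* coeff g k)
    a·g-above k j<k = multipleOfP-*ˡ (if 0) (aboveg k j<k)
    split : ∀ k → coeff ((a ∷ as) *ₚ g) (suc k) ≡ a ℚ.* coeff g (suc k) ℚ.+ coeff (as *ₚ g) k
    split k = trans (coeff-+ₚ (a ·ₚ g) _ (suc k)) (cong (ℚ._+ _) (coeff-·ₚ a g (suc k)))

  record PrimitiveMultiple (f : Poly) : Set where
    field
      scale      : ℚ
      scale≢0    : scale ≢ 0ℚ
      integral   : IntegralPoly (scale ·ₚ f)
      degreeModP : Σ ℕ (DegreeModP (scale ·ₚ f))

  PrimitiveMultiple-·ₚ : ∀ {c} f → c ≢ 0ℚ → PrimitiveMultiple (c ·ₚ f) → PrimitiveMultiple f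
  PrimitiveMultiple-·ₚ {c} f c≢0 pm = record
    { scale      = scale ℚ.* c
    ; scale≢0    = *-≢0 scale≢0 c≢0
    ; integral   = IntegralPoly-≋ (·ₚ-assoc scale c f) integral
    ; degreeModP = proj₁ degreeModP , DegreeModP-≋ (·ₚ-assoc scale c f) (proj₂ degreeModP) }
    where open PrimitiveMultiple pm

  -- Divide by p as long as all coefficients are multiples of p; the nonzero
  -- coefficient z of X ^ k strictly decreases in absolute value.
  primitiveMultiple-integral : ∀ f {k} z → Acc _<_ ℤ.∣ z ∣ → IntegralPoly f → coeff f k ≡ ι z → z ≢ + 0 →
                               PrimitiveMultiple f
  primitiveMultiple-integral f {k} z (acc rs) if fk≡z z≢0 with zeroModP-or-degreeModP f if
  ... | inj₂ (i , df) = record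
    { scale = 1ℚ ; scale≢0 = λ () ; integral = IntegralPoly-≋ (≋-sym (·ₚ-identity f)) if
    ; degreeModP = i , DegreeModP-≋ (≋-sym (·ₚ-identity f)) df }
  ... | inj₁ zf with zf k
  ...   | w , fk≡wp = PrimitiveMultiple-·ₚ f (recip-≢0 (ι pℤ) ιp≢0)
          (primitiveMultiple-integral (p⁻¹ ·ₚ f) w (rs ∣w∣<∣z∣) (p⁻¹·ₚ-integral f zf) p⁻¹fk≡w w≢0)
    where
    z≡wp : z ≡ w ℤ.* pℤ
    z≡wp = ι-injective (trans (sym fk≡z) fk≡wp)
    w≢0 : w ≢ + 0
    w≢0 refl = z≢0 z≡wp
    ∣w∣<∣z∣ : ℤ.∣ w ∣ < ℤ.∣ z ∣
    ∣w∣<∣z∣ = subst (λ x → ℤ.∣ w ∣ < ℤ.∣ x ∣) (sym z≡wp) (∣w∣<∣w*p∣ w w≢0)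
    p⁻¹fk≡w : coeff (p⁻¹ ·ₚ f) k ≡ ι w
    p⁻¹fk≡w = trans (coeff-·ₚ p⁻¹ f k) (trans (cong (p⁻¹ ℚ.*_) fk≡wp) (p⁻¹-cancel w))

  primitiveMultiple : ∀ {f k} → Degree f k → PrimitiveMultiple f
  primitiveMultiple {f} {k} (mkDegree lead≢0 _) with clearDenominators f
  ... | δ , δ≢0 , iδf with iδf k
  ...   | z , δfk≡z = PrimitiveMultiple-·ₚ f (ι-pos≢0 {δ} δ≢0)
                        (primitiveMultiple-integral (ι (+ δ) ·ₚ f) z (<-wellFounded ℤ.∣ z ∣) iδf δfk≡z z≢0)
    where
    z≢0 : z ≢ + 0
    z≢0 refl = *-≢0 (ι-pos≢0 {δ} δ≢0) lead≢0 (trans (sym (coeff-·ₚ (ι (+ δ)) f k)) δfk≡z)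

  record IntegralCofactor (G A : Poly) : Set where
    field
      multiplier    : ℕ
      p∤multiplier  : ¬ p ∣ multiplier
      cofactor      : Poly
      integral      : IntegralPoly cofactor
      factorisation : ι (+ multiplier) ·ₚ G ≋ A *ₚ cofactor

  -- While p ∣ c, the cofactor T must vanish modulo p, since A does not and c G does;
  -- so p can be divided out of both c and T.
  integralCofactor : ∀ {G A i} → IntegralPoly G → IntegralPoly A → DegreeModP A i →
    ∀ c → Acc _<_ c → c ≢ 0 → ∀ T → IntegralPoly T → ι (+ c) ·ₚ G ≋ A *ₚ T → IntegralCofactor G A
  integralCofactor {G} {A} iG iA dA c (acc rs) c≢0 T iT cG≋AT with p ∣? c
  ... | no p∤c = record { multiplier = c ; p∤multiplier = p∤c ; cofactor = T ; integral = iT ; factorisation = cG≋AT }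
  ... | yes (divides q c≡qp) with zeroModP-or-degreeModP T iT
  ...   | inj₂ (j , dT) =
          ⊥-elim (DegreeModP⇒¬ZeroModP (DegreeModP-≋ (≋-sym cG≋AT) (DegreeModP-*ₚ A T iA iT dA dT))
                                       (multipleOfP-·ₚ G (+ q , cong ι +c≡qp) iG))
    where
    +c≡qp : + c ≡ + q ℤ.* pℤ
    +c≡qp = trans (cong +_ c≡qp) (ℤP.pos-* q p)
  ...   | inj₁ zT = integralCofactor iG iA dA q (rs q<c) q≢0 (p⁻¹ ·ₚ T) (p⁻¹·ₚ-integral T zT) (begin
    ι (+ q) ·ₚ G                  ≈⟨ ·ₚ-cong (trans (cong (λ x → p⁻¹ ℚ.* ι x) +c≡qp) (p⁻¹-cancel (+ q))) ≋-refl ⟨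
    (p⁻¹ ℚ.* ι (+ c)) ·ₚ G        ≈⟨ ·ₚ-assoc p⁻¹ (ι (+ c)) G ⟨
    p⁻¹ ·ₚ (ι (+ c) ·ₚ G)         ≈⟨ ·ₚ-cong refl cG≋AT ⟩
    p⁻¹ ·ₚ (A *ₚ T)               ≈⟨ *ₚ-·ₚ-comm p⁻¹ A T ⟨
    A *ₚ (p⁻¹ ·ₚ T)               ∎)
    where
    open ≋-Reasoning
    +c≡qp : + c ≡ + q ℤ.* pℤ
    +c≡qp = trans (cong +_ c≡qp) (ℤP.pos-* q p)
    q≢0 : q ≢ 0
    q≢0 refl = c≢0 c≡qp
    q<c : q < c
    q<c = subst (q <_) (sym c≡qp) (ℕP.m<m*n q p {{ℕ.≢-nonZero q≢0}} p>1)

  ¬multipleOfP-ι : ∀ {z} → ¬ p ∣ ℤ.∣ z ∣ → ¬ MultipleOfP (ι z)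
  ¬multipleOfP-ι {z} p∤z m = p∤z (multipleOfP⇒∣ z m)

  p⁻¹-*-cancel : ∀ x w → p⁻¹ ℚ.* (x ℚ.* ι (w ℤ.* pℤ)) ≡ x ℚ.* ι w
  p⁻¹-*-cancel x w = begin
    p⁻¹ ℚ.* (x ℚ.* ι (w ℤ.* pℤ))     ≡⟨ solve 3 (λ P X Y → P :* (X :* Y) := X :* (P :* Y)) refl p⁻¹ x (ι (w ℤ.* pℤ)) ⟩
    x ℚ.* (p⁻¹ ℚ.* ι (w ℤ.* pℤ))     ≡⟨ cong (x ℚ.*_) (p⁻¹-cancel w) ⟩
    x ℚ.* ι w                        ∎
    where
    open ≡-Reasoning
    open ℚ-Solver

  -- p divides the leading coefficient of c G exactly once, but that of E (E T₁) twice.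
  ¬≋square-with-p∣lead : ∀ {G n E T₁ c k} u → Degree G n → coeff G n ≡ ι (u ℤ.* pℤ) → ¬ p ∣ ℤ.∣ u ∣ →
    ¬ p ∣ c → Degree E (suc k) → MultipleOfP (coeff E (suc k)) → IntegralPoly T₁ →
    ¬ ι (+ c) ·ₚ G ≋ E *ₚ (E *ₚ T₁)
  ¬≋square-with-p∣lead {G} {n} {E} {T₁} {c} {k} u dG lead≡up p∤u p∤c dE (w , lE≡wp) iT cG≋EET =
    ¬multipleOfP-* (ι-isInteger (+ c)) (ι-isInteger u) (¬multipleOfP-ι {+ c} p∤c) (¬multipleOfP-ι {u} p∤u)
      (subst MultipleOfP (p⁻¹-*-cancel (ι (+ c)) u) (subst MultipleOfP (cong (p⁻¹ ℚ.*_) (sym c·lead)) p⁻¹·rhs))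
    where
    open ≡-Reasoning
    c≢0 : c ≢ 0
    c≢0 refl = p∤c (divides 0 refl)
    dcG = Degree-·ₚ (ι-pos≢0 {c} c≢0) dG
    T₁-degree : Σ ℕ (Degree T₁)
    T₁-degree = Degree-cofactor E (proj₂ (Degree-cofactor E (Degree-≋ cG≋EET dcG)))
    l  = proj₁ T₁-degree
    dT = proj₂ T₁-degree
    dEET = Degree-*ₚ dE (Degree-*ₚ dE dT)
    lE = coeff E (suc k)
    lT = coeff T₁ l
    n≡ : n ≡ suc k + (suc k + l)
    n≡ = Degree-unique (Degree-≋ cG≋EET dcG) dEET
    c·lead : ι (+ c) ℚ.* ι (u ℤ.* pℤ) ≡ (lE ℚ.* lT) ℚ.* ι (w ℤ.* pℤ)
    c·lead = begin
      ι (+ c) ℚ.* ι (u ℤ.* pℤ)                        ≡⟨ cong (ι (+ c) ℚ.*_) lead≡up ⟨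
      ι (+ c) ℚ.* coeff G n                           ≡⟨ coeff-·ₚ (ι (+ c)) G n ⟨
      coeff (ι (+ c) ·ₚ G) n                          ≡⟨ coeff≡ cG≋EET n ⟩
      coeff (E *ₚ (E *ₚ T₁)) n                        ≡⟨ cong (coeff (E *ₚ (E *ₚ T₁))) n≡ ⟩
      coeff (E *ₚ (E *ₚ T₁)) (suc k + (suc k + l))    ≡⟨ coeff-*ₚ-leading dE (Degree-*ₚ dE dT) ⟩
      lE ℚ.* coeff (E *ₚ T₁) (suc k + l)              ≡⟨ cong (lE ℚ.*_) (coeff-*ₚ-leading dE dT) ⟩
      lE ℚ.* (lE ℚ.* lT)                              ≡⟨ solve 2 (λ A B → A :* (A :* B) := (A :* B) :* A) refl lE lT ⟩
      (lE ℚ.* lT) ℚ.* lE                              ≡⟨ cong ((lE ℚ.* lT) ℚ.*_) lE≡wp ⟩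
      (lE ℚ.* lT) ℚ.* ι (w ℤ.* pℤ)                    ∎
      where open ℚ-Solver
    p⁻¹·rhs : MultipleOfP (p⁻¹ ℚ.* ((lE ℚ.* lT) ℚ.* ι (w ℤ.* pℤ)))
    p⁻¹·rhs = subst MultipleOfP (sym (p⁻¹-*-cancel (lE ℚ.* lT) w))
                (multipleOfP-*ʳ (multipleOfP-*ʳ (w , lE≡wp) (iT l)) (ι-isInteger w))

  degreeModP-zero-if-∣unit : ∀ E W {c i} → IntegralPoly E → IntegralPoly W → DegreeModP E i →
    ZeroModP (E *ₚ W -ₚ constP c) → ¬ MultipleOfP c → i ≡ 0
  degreeModP-zero-if-∣unit E W {c} {i} iE iW dE EW≡c ¬mc with zeroModP-or-degreeModP W iW
  ... | inj₁ zW = ⊥-elim (¬mc (ZeroModP-≋ c≋ (ZeroModP--ₚ (E *ₚ W) (ZeroModP-*ₚʳ E iE zW) EW≡c) 0))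
    where
    c≋ : E *ₚ W -ₚ (E *ₚ W -ₚ constP c) ≋ constP c
    c≋ = solve 2 (λ X C → X :- (X :- C) := C) ≋-refl (E *ₚ W) (constP c)
      where open PolySolver
  ... | inj₂ (j , dW) = ℕP.m+n≡0⇒m≡0 i (i+j≡0 (i + j) (DegreeModP-*ₚ E W iE iW dE dW))
    where
    i+j≡0 : ∀ m → DegreeModP (E *ₚ W) m → m ≡ 0
    i+j≡0 zero    _                      = refl
    i+j≡0 (suc m) (mkDegreeModP lead≢0 _) = ⊥-elim (lead≢0 (subst MultipleOfP coeff-above-constant (EW≡c (suc m))))
      where
      coeff-above-constant : coeff (E *ₚ W -ₚ constP c) (suc m) ≡ coeff (E *ₚ W) (suc m)
      coeff-above-constant = trans (coeff--ₚ (E *ₚ W) (constP c) (suc m)) (ℚP.+-identityʳ _)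

  square-factor-constantModP : ∀ {G H E T c i} → IntegralPoly E → IntegralPoly T → DegreeModP E i →
    (bz : IntegralBezout H) → ¬ p ∣ ℤ.∣ IntegralBezout.D bz ∣ → ZeroModP (G -ₚ H) → ¬ p ∣ c →
    ι (+ c) ·ₚ G ≋ E *ₚ (E *ₚ T) → i ≡ 0
  square-factor-constantModP {G} {H} {E} {T} {c} iE iT dE bz p∤D G≡H p∤c cG≋EET =
    degreeModP-zero-if-∣unit E W iE iW dE (ZeroModP-≋ (≋-sym EW-cD≋) c·[G-H]≡0)
      (¬multipleOfP-* (ι-isInteger (+ c)) (ι-isInteger D) (¬multipleOfP-ι {+ c} p∤c) (¬multipleOfP-ι {D} p∤D))
    where
    open IntegralBezout bz
    Y = E *ₚ T
    W = u *ₚ Y +ₚ v *ₚ (deriv E *ₚ T +ₚ deriv Y)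
    iY = IntegralPoly-*ₚ E iE iT
    iW : IntegralPoly W
    iW = IntegralPoly-+ₚ (u *ₚ Y) (IntegralPoly-*ₚ u u-integral iY)
           (IntegralPoly-*ₚ v v-integral (IntegralPoly-+ₚ (deriv E *ₚ T) (IntegralPoly-*ₚ (deriv E) (IntegralPoly-deriv E iE) iT)
                                                          (IntegralPoly-deriv Y iY)))
    EW-cD≋ : E *ₚ W -ₚ constP (ι (+ c) ℚ.* ι D) ≋ ι (+ c) ·ₚ (u *ₚ (G -ₚ H) +ₚ v *ₚ (deriv G -ₚ deriv H))
    EW-cD≋ = square-factor-bezout {G} {H} {E} {T} {u} {v} (ι (+ c)) (ι D) bezout cG≋EET
    c·[G-H]≡0 : ZeroModP (ι (+ c) ·ₚ (u *ₚ (G -ₚ H) +ₚ v *ₚ (deriv G -ₚ deriv H)))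
    c·[G-H]≡0 = ZeroModP-·ₚ {ι (+ c)} (u *ₚ (G -ₚ H) +ₚ v *ₚ (deriv G -ₚ deriv H)) (ι-isInteger (+ c))
      (ZeroModP-+ₚ (u *ₚ (G -ₚ H)) (ZeroModP-*ₚʳ u u-integral G≡H)
        (ZeroModP-*ₚʳ v v-integral (ZeroModP-≋ (deriv--ₚ G H) (ZeroModP-deriv (G -ₚ H) G≡H))))

  squareFree-if-separableModP : ∀ {G H n} u → IntegralPoly H → (bz : IntegralBezout H) → ¬ p ∣ ℤ.∣ IntegralBezout.D bz ∣ →
    ZeroModP (G -ₚ H) → Degree G n → coeff G n ≡ ι (u ℤ.* pℤ) → ¬ p ∣ ℤ.∣ u ∣ → SquareFree G
  squareFree-if-separableModP {G} {H} u iH bz p∤D G≡H dG lead≡up p∤u e S e≉const G≋eeS =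
    ¬≋square-with-p∣lead u dG lead≡up p∤u p∤multiplier dE lead-E≡0 integral (≋-trans factorisation (*ₚ-assoc E E cofactor))
    where
    open ≋-Reasoning
    k  = proj₁ (¬IsConst⇒Degree-suc {e} e≉const)
    de = proj₂ (¬IsConst⇒Degree-suc {e} e≉const)
    pm = primitiveMultiple de
    κ   = PrimitiveMultiple.scale pm
    κ≢0 = PrimitiveMultiple.scale≢0 pm
    E   = κ ·ₚ e
    iE  = PrimitiveMultiple.integral pm
    i   = proj₁ (PrimitiveMultiple.degreeModP pm)
    dEp = proj₂ (PrimitiveMultiple.degreeModP pm)
    dE  = Degree-·ₚ κ≢0 de
    T   = recip (κ ℚ.* κ) (*-≢0 κ≢0 κ≢0) ·ₚ S
    iG : IntegralPoly G
    iG = IntegralPoly-≋ (solve 2 (λ G H → (G :- H) :+ H := G) ≋-refl G H)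
                        (IntegralPoly-+ₚ (G -ₚ H) (ZeroModP⇒IntegralPoly {G -ₚ H} G≡H) iH)
      where open PolySolver
    δ    = proj₁ (clearDenominators T)
    δ≢0  = proj₁ (proj₂ (clearDenominators T))
    iδT  = proj₂ (proj₂ (clearDenominators T))
    δG≋EEδT : ι (+ δ) ·ₚ G ≋ (E *ₚ E) *ₚ (ι (+ δ) ·ₚ T)
    δG≋EEδT = begin
      ι (+ δ) ·ₚ G                       ≈⟨ ·ₚ-cong refl (≋-trans G≋eeS (rescale-square κ≢0 e S)) ⟩
      ι (+ δ) ·ₚ (E *ₚ (E *ₚ T))         ≈⟨ ·ₚ-cong refl (*ₚ-assoc E E T) ⟨
      ι (+ δ) ·ₚ ((E *ₚ E) *ₚ T)         ≈⟨ *ₚ-·ₚ-comm (ι (+ δ)) (E *ₚ E) T ⟨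
      (E *ₚ E) *ₚ (ι (+ δ) ·ₚ T)         ∎
    cof = integralCofactor iG (IntegralPoly-*ₚ E iE iE) (DegreeModP-*ₚ E E iE iE dEp dEp)
                           δ (<-wellFounded δ) δ≢0 (ι (+ δ) ·ₚ T) iδT δG≋EEδT
    open IntegralCofactor cof
    i≡0 : i ≡ 0
    i≡0 = square-factor-constantModP iE integral dEp bz p∤D G≡H p∤multiplier (≋-trans factorisation (*ₚ-assoc E E cofactor))
    lead-E≡0 : MultipleOfP (coeff E (suc k))
    lead-E≡0 = DegreeModP.above dEp (suc k) (subst (_< suc k) (sym i≡0) (s≤s z≤n))

  perturbation-squareFree : ∀ {h L d e n m z} → Degree h d → 1 ≤ d → Monic L e → 1 ≤ e → IntegralPoly L →
    m ≢ + 0 → IntegralPoly (ι m ·ₚ h) → coeff (ι m ·ₚ h) d ≡ ι z → ¬ p ∣ ℤ.∣ z ∣ → ¬ p ∣ n →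
    (bz : IntegralBezout (ι m ·ₚ h)) → ¬ p ∣ ℤ.∣ IntegralBezout.D bz ∣ →
    SquareFree (h +ₚ (ι pℤ ℚ.* ι (+ n)) ·ₚ (L *ₚ (h -ₚ oneP)))
  perturbation-squareFree {h} {L} {d} {e} {n} {m} {z} dh 1≤d mL 1≤e iL m≢0 imh mlead≡z p∤z p∤n bz p∤D =
    SquareFree-·ₚ⁻¹ F (ι≢0 m≢0)
      (squareFree-if-separableModP (+ n ℤ.* z) imh bz p∤D G≡H (Degree-·ₚ (ι≢0 m≢0) (proj₁ F-degree)) lead≡ p∤nz)
    where
    c = ι pℤ ℚ.* ι (+ n)
    F = h +ₚ c ·ₚ (L *ₚ (h -ₚ oneP))
    n≢0 : n ≢ 0
    n≢0 refl = p∤n (divides 0 refl)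
    F-degree = perturbation-degree dh 1≤d mL 1≤e (*-≢0 ιp≢0 (ι-pos≢0 {n} n≢0))
    lead≡ : coeff (ι m ·ₚ F) (e + d) ≡ ι ((+ n ℤ.* z) ℤ.* pℤ)
    lead≡ = begin
      coeff (ι m ·ₚ F) (e + d)                     ≡⟨ coeff-·ₚ (ι m) F (e + d) ⟩
      ι m ℚ.* coeff F (e + d)                      ≡⟨ cong (ι m ℚ.*_) (proj₂ F-degree) ⟩
      ι m ℚ.* ((ι pℤ ℚ.* ι (+ n)) ℚ.* coeff h d)   ≡⟨ solve 4 (λ M P N l → M :* ((P :* N) :* l) := (N :* (M :* l)) :* P) refl (ι m) (ι pℤ) (ι (+ n)) (coeff h d) ⟩
      (ι (+ n) ℚ.* (ι m ℚ.* coeff h d)) ℚ.* ι pℤ   ≡⟨ cong (λ x → (ι (+ n) ℚ.* x) ℚ.* ι pℤ) (trans (sym (coeff-·ₚ (ι m) h d)) mlead≡z) ⟩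
      (ι (+ n) ℚ.* ι z) ℚ.* ι pℤ                   ≡⟨ trans (cong (ℚ._* ι pℤ) (sym (ι-* (+ n) z))) (sym (ι-* (+ n ℤ.* z) pℤ)) ⟩
      ι ((+ n ℤ.* z) ℤ.* pℤ)                       ∎
      where
      open ≡-Reasoning
      open ℚ-Solver
    G≡H : ZeroModP (ι m ·ₚ F -ₚ ι m ·ₚ h)
    G≡H = ZeroModP-≋ (≋-sym (scaled-perturbation-difference (ι m) (ι pℤ) (ι (+ n)) L h))
            (p·ₚ-zeroModP (ι (+ n) ·ₚ (L *ₚ (ι m ·ₚ h -ₚ constP (ι m)))) (IntegralPoly-·ₚ {ι (+ n)} (L *ₚ (ι m ·ₚ h -ₚ constP (ι m))) (ι-isInteger (+ n))
              (IntegralPoly-*ₚ L iL (IntegralPoly--ₚ (ι m ·ₚ h) {constP (ι m)} imh (IntegralPoly-constP m)))))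
    p∤nz : ¬ p ∣ ℤ.∣ + n ℤ.* z ∣
    p∤nz p∣nz = [ p∤n , p∤z ]′ (euclidsLemma n ℤ.∣ z ∣ p-prime (subst (p ∣_) (ℤP.abs-* (+ n) z) p∣nz))

  perturbation-separable : ∀ {h L d e n m z} → Degree h d → 1 ≤ d → Monic L e → 1 ≤ e → IntegralPoly L →
    m ≢ + 0 → IntegralPoly (ι m ·ₚ h) → coeff (ι m ·ₚ h) d ≡ ι z → ¬ p ∣ ℤ.∣ z ∣ → ¬ p ∣ n →
    (bz : IntegralBezout (ι m ·ₚ h)) → ¬ p ∣ ℤ.∣ IntegralBezout.D bz ∣ →
    Separable (h +ₚ (ι pℤ ℚ.* ι (+ n)) ·ₚ (L *ₚ (h -ₚ oneP)))
  perturbation-separable {n = n} {m} {z} dh 1≤d mL 1≤e iL m≢0 imh mlead≡z p∤z p∤n bz p∤D =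
    squareFree⇒separable _
      (Degree⇒≉[] (proj₁ (perturbation-degree dh 1≤d mL 1≤e (*-≢0 ιp≢0 (ι-pos≢0 {n} λ { refl → p∤n (divides 0 refl) })))))
      (perturbation-squareFree {m = m} {z} dh 1≤d mL 1≤e iL m≢0 imh mlead≡z p∤z p∤n bz p∤D)

Separable-≋ : ∀ {F F′} → F ≋ F′ → Separable F → Separable F′
Separable-≋ {F} {F′} F≋F′ (u , v , bezout) = u , v , coeff≡ (begin
  u *ₚ F′ +ₚ v *ₚ deriv F′      ≈⟨ +ₚ-cong (*ₚ-congʳ u F≋F′) (*ₚ-congʳ v (deriv-cong F≋F′)) ⟨
  u *ₚ F +ₚ v *ₚ deriv F        ≈⟨ mk≋ bezout ⟩
  oneP                          ∎)
  where open ≋-Reasoning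

¬∣-if-bounded : ∀ {p k B} → k ≢ 0 → k ≤ B → B < p → ¬ p ∣ k
¬∣-if-bounded k≢0 k≤B B<p = >⇒∤ {{ℕ.≢-nonZero k≢0}} (ℕP.≤-<-trans k≤B B<p)

prime∣^⇒∣ : ∀ {q} n k → Prime q → q ∣ n ℕ.^ k → q ∣ n
prime∣^⇒∣ {q} n zero    q-prime q∣1 = ⊥-elim (ℕP.<⇒≢ (ℕ.nonTrivial⇒n>1 q {{prime⇒nonTrivial q-prime}}) (sym (∣1⇒≡1 q∣1)))
prime∣^⇒∣     n (suc k) q-prime q∣nᵏ = [ id , prime∣^⇒∣ n k q-prime ]′ (euclidsLemma n (n ℕ.^ k) q-prime q∣nᵏ)

prodFin≢0 : ∀ n (f : Fin n → ℤ) → (∀ i → f i ≢ + 0) → prodFin n f ≢ + 0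
prodFin≢0 zero    f f≢0 ()
prodFin≢0 (suc n) f f≢0 e =
  [ f≢0 Fin.zero , prodFin≢0 n (λ k → f (Fin.suc k)) (λ i → f≢0 (Fin.suc i)) ]′ (ℤP.i*j≡0⇒i≡0∨j≡0 (f Fin.zero) e)

mProd≢0 : ∀ r (a : Fin r → ℤ) → (∀ i j → a i ≡ a j → i ≡ j) → mProd r a ≢ + 0
mProd≢0 zero    a a-injective ()
mProd≢0 (suc r) a a-injective e =
  [ prodFin≢0 r _ (λ k a₀-aₖ≡0 → FinP.0≢1+n (a-injective Fin.zero (Fin.suc k) (ℤP.i-j≡0⇒i≡j _ _ a₀-aₖ≡0)))
  , mProd≢0 r (λ k → a (Fin.suc k)) (λ i j e′ → FinP.suc-injective (a-injective (Fin.suc i) (Fin.suc j) e′)) ]′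
  (ℤP.i*j≡0⇒i≡0∨j≡0 (prodFin r (λ k → a Fin.zero ℤ.- a (Fin.suc k))) e)

rad≢0 : ∀ n → rad n ≢ 0
rad≢0 n = ℕ.≢-nonZero⁻¹ (rad n) {{productOfPrimes≢0 (All.map proj₁ (all-filter (λ q → prime? q ×-dec q ∣? n) (upTo (suc n))))}}

lemma4p2 : (r : ℕ) → 2 ≤ r → (a b : Fin r → ℤ) → Acceptable r a b →
    (h : Poly) → Irreducible h → HasDegree h (6 * r + 3) →
    (∀ i → eval h (ι (a i)) ≡ ι (b i ℤ.^ (18 * r + 3))) →
    IntegralPoly (ι (mProd r a) ·ₚ h) →
    Σ ℕ λ B → (p : ℕ) → Prime p → B < p →
      Separable (((h -ₚ oneP) *ₚ gPoly r a (ι (+ p))) +ₚ oneP)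
lemma4p2 r r≥2 a _ (a-injective , _) h h-irreducible (lead≢0 , above) _ mh-integral = B , separable
  where
  m   = mProd r a
  N   = rad ℤ.∣ m ∣
  z   = proj₁ (mh-integral (6 * r + 3))
  m≢0 = mProd≢0 r a a-injective
  bz  = integralBezout h m (irreducible⇒separable h h-irreducible) m≢0
  D   = IntegralBezout.D bz
  B   = N + ℤ.∣ z ∣ + ℤ.∣ D ∣
  ∣z∣≢0 : ℤ.∣ z ∣ ≢ 0
  ∣z∣≢0 ∣z∣≡0 = *-≢0 (ι≢0 m≢0) lead≢0 (trans (sym (coeff-·ₚ (ι m) h (6 * r + 3)))
                  (trans (proj₂ (mh-integral (6 * r + 3))) (cong ι (ℤP.∣i∣≡0⇒i≡0 {z} ∣z∣≡0))))
  ∣D∣≢0 : ℤ.∣ D ∣ ≢ 0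
  ∣D∣≢0 ∣D∣≡0 = IntegralBezout.D≢0 bz (ℤP.∣i∣≡0⇒i≡0 {D} ∣D∣≡0)
  N≤B   = ℕP.≤-trans (ℕP.m≤m+n N ℤ.∣ z ∣) (ℕP.m≤m+n (N + ℤ.∣ z ∣) ℤ.∣ D ∣)
  ∣z∣≤B = ℕP.≤-trans (ℕP.m≤n+m ℤ.∣ z ∣ N) (ℕP.m≤m+n (N + ℤ.∣ z ∣) ℤ.∣ D ∣)
  ∣D∣≤B = ℕP.m≤n+m ℤ.∣ D ∣ (N + ℤ.∣ z ∣)
  1≤6r+3 = ℕP.≤-trans (s≤s z≤n) (ℕP.m≤n+m 3 (6 * r))
  1≤6r   = ℕP.≤-trans (ℕP.≤-trans (s≤s z≤n) r≥2) (ℕP.m≤n*m r 6)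
  separable : ∀ p → Prime p → B < p → Separable (((h -ₚ oneP) *ₚ gPoly r a (ι (+ p))) +ₚ oneP)
  separable p p-prime B<p =
    Separable-≋ (≋-sym (perturbation-expansion h _ (prodLin r a ^ₚ 6)))
      (perturbation-separable {n = N ℕ.^ 6} {m} {z} (mkDegree lead≢0 above) 1≤6r+3 (Monic-^ₚ 6 (Monic-prodLin r a)) 1≤6r
         (IntegralPoly-^ₚ (prodLin r a) 6 (IntegralPoly-prodLin r a)) m≢0 mh-integral (proj₂ (mh-integral (6 * r + 3)))
         (p∤ ∣z∣≢0 ∣z∣≤B) (λ p∣N⁶ → p∤ (rad≢0 ℤ.∣ m ∣) N≤B (prime∣^⇒∣ N 6 p-prime p∣N⁶)) bz (p∤ ∣D∣≢0 ∣D∣≤B))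
    where
    open ModPrime p p-prime
    p∤ : ∀ {k} → k ≢ 0 → k ≤ B → ¬ p ∣ k
    p∤ k≢0 k≤B = ¬∣-if-bounded k≢0 k≤B B<p
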